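{- For a non-negative integer $v$ let $\vartheta(v)=4l$ if $v\in\{4l+2,4l+3\}$ and $\vartheta(v)=4l-3$ if $v\in\{4l,4l+1\}$. Let $v=m+r$ where $r\in\{2,3,4\}$ and $m$ is a product of prime powers each congruent to $1$ modulo $4$. Then there are two graphs $G$ and $G'$ on the same set of $v$ vertices which are $k$-hypomorphic up to complementation for every $k$ with $\vartheta(v)+1\leq k\leq v$, but $G'\neq G$ and $G'\neq\overline G$.
   Context: A graph is a pair $G=(V,E)$ with $E$ a set of 2-element subsets of $V$; $\overline G$ is its complement and $G_{\restriction K}$ the induced subgraph on $K$. Two graphs are isomorphic up to complementation if one is isomorphic to the other or to its complement; $G,G'$ on $V$ are $k$-hypomorphic up to complementation if $G_{\restriction K}$ and $G'_{\restriction K}$ are isomorphic up to complementation for every $k$-element $K\subseteq V$. -}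

module Defs where

open import Data.Nat using (ℕ; zero; suc; _+_; _*_; _∸_; _^_; _≤_; _%_; _/_)
open import Data.Nat.Primality using (Prime)
open import Data.Bool using (Bool; true; false; not; if_then_else_)
open import Data.Fin using (Fin; _≟_)
open import Data.Fin.Subset using (Subset; _∈_; ∣_∣)
open import Data.List using (List)
open import Data.Nat.ListAction using (product)
open import Data.List.Relation.Unary.All using (All)
open import Data.Product using (Σ; ∃; _×_; _,_; proj₁)
open import Data.Sum using (_⊎_)
open import Relation.Nullary using (¬_; yes; no)
open import Relation.Binary.PropositionalEquality using (_≡_; refl; sym)
open import Function.Bundles using (_↔_; Inverse)

record Graph (n : ℕ) : Set where
  field
    adj    : Fin n → Fin n → Bool
    adj-sym : ∀ x y → adj x y ≡ adj y x
    adj-irrefl : ∀ x → adj x x ≡ false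
open Graph public

compl-adj : ∀ {n} → Graph n → Fin n → Fin n → Bool
compl-adj G x y with x ≟ y
... | yes _ = false
... | no _  = not (adj G x y)

private
  compl-sym : ∀ {n} (G : Graph n) x y → compl-adj G x y ≡ compl-adj G y x
  compl-sym G x y with x ≟ y | y ≟ x
  ... | yes _ | yes _ = refl
  ... | yes refl | no ne = Data.Empty.⊥-elim (ne refl)
    where import Data.Empty
  ... | no ne | yes refl = Data.Empty.⊥-elim (ne refl)
    where import Data.Empty
  ... | no _ | no _ rewrite adj-sym G x y = refl

  compl-irrefl : ∀ {n} (G : Graph n) x → compl-adj G x x ≡ false
  compl-irrefl G x with x ≟ x
  ... | yes _ = refl
  ... | no ne = Data.Empty.⊥-elim (ne refl)
    where import Data.Empty

complement : ∀ {n} → Graph n → Graph n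
complement G = record
  { adj = compl-adj G ; adj-sym = compl-sym G ; adj-irrefl = compl-irrefl G }

SameGraph : ∀ {n} → Graph n → Graph n → Set
SameGraph G H = ∀ x y → adj G x y ≡ adj H x y

Elt : ∀ {n} → Subset n → Set
Elt K = Σ (Fin _) (λ x → x ∈ K)

IsoInduced : ∀ {n} → Graph n → Graph n → Subset n → Set
IsoInduced G H K =
  Σ (Elt K ↔ Elt K) λ f →
    ∀ (a b : Elt K) →
      adj G (proj₁ a) (proj₁ b) ≡ adj H (proj₁ (Inverse.to f a)) (proj₁ (Inverse.to f b))

-- G restricted to K and H restricted to K are isomorphic up to complementation
-- (note: the induced subgraph of the complement is the complement of the induced subgraph)
IsoUpToComplInduced : ∀ {n} → Graph n → Graph n → Subset n → Set
IsoUpToComplInduced G H K = IsoInduced G H K ⊎ IsoInduced G (complement H) K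

HypomorphicUpToCompl : ∀ {n} → ℕ → Graph n → Graph n → Set
HypomorphicUpToCompl {n} k G H =
  ∀ (K : Subset n) → ∣ K ∣ ≡ k → IsoUpToComplInduced G H K

-- ϑ(v) = 4l if v ∈ {4l+2, 4l+3}; 4l - 3 if v ∈ {4l, 4l+1}
-- (truncated subtraction; only differs from the paper for v ∈ {0,1})
theta : ℕ → ℕ
theta v with v % 4
... | 0 = 4 * (v / 4) ∸ 3
... | 1 = 4 * (v / 4) ∸ 3
... | _ = 4 * (v / 4)

IsPrimePower : ℕ → Set
IsPrimePower q = ∃ λ p → ∃ λ e → Prime p × 1 ≤ e × q ≡ p ^ e

ProdPrimePowers1mod4 : ℕ → Set
ProdPrimePowers1mod4 m =
  Σ (List ℕ) λ qs → All (λ q → IsPrimePower q × q % 4 ≡ 1) qs × m ≡ product qs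

module Submission where

-- The core of both graphs is a graph P on m vertices having, for every vertex x, an antimorphism
-- (an isomorphism onto its complement) fixing x. Paley-type Cayley graphs on finite ℤ[i]-modules
-- without 2-torsion have this property: ℤ/p for a prime p ≡ 1 (mod 4), with i a square root of −1
-- modulo p, and (ℤ/n)² for odd n. Lexicographic products preserve it, and every m of the statement
-- is a product of such orders: a prime power q ≡ 1 (mod 4) is either an odd square or a power of a
-- prime p ≡ 1 (mod 4).
-- G and G′ extend P by r extra vertices in two different ways, chosen so that on every set v of extra
-- vertices they either match directly, or v is small and they match after complementing. For K with
-- |K| = k ≥ ϑ(m + r) + 1, a direct matching of the extra vertices of K together with the identity on
-- the core gives G[K] ≅ G′[K]; otherwise K misses at most one core vertex x, and an antimorphism of P
-- fixing x together with the complementing matching gives G[K] ≅ complement of G′[K].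

open import Defs
open import Level using (0ℓ)
open import Algebra.Bundles using (AbelianGroup)
open import Algebra.Construct.DirectProduct using () renaming (abelianGroup to _×-abelianGroup_)
import Algebra.Properties.AbelianGroup as AbelianGroupProperties
import Algebra.Properties.CommutativeSemigroup as CommutativeSemigroupProperties
open import Data.Nat
  using (ℕ; zero; suc; _+_; _*_; _∸_; _^_; _%_; _/_; _⊓_; _≤_; _<_; _≤?_; _<ᵇ_; _≟_; z≤n; s≤s; z<s; s<s)
open import Data.Nat.Properties
  using (+-assoc; +-comm; +-suc; +-identityʳ; *-comm; *-assoc; *-zeroʳ; *-identityʳ; *-distribˡ-+;
         ^-distribˡ-+-*; ⊓-comm; ⊓-sel; m≤m+n; ≤-refl; ≤-trans; ≤-reflexive; <-≤-trans; <⇒≤; ≰⇒>; 1+n≰n; n<1+n;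
         +-mono-≤; +-monoʳ-≤; +-monoˡ-≤; +-cancelʳ-≤; ∸-monoʳ-<; m+n∸m≡n; m∸n+n≡m; suc-injective;
         even≢odd; +-0-commutativeMonoid; module ≤-Reasoning)
open import Data.Nat.DivMod
  using (%-distribˡ-+; %-distribˡ-*; m%n<n; m%n%n≡m%n; m<n⇒m%n≡m; m*n%n≡0; [m+kn]%n≡m%n;
         m≡m%n+[m/n]*n; m∣n⇒o%n%m≡o%m; +-distrib-/-∣ʳ; m*n/n≡m; m<n⇒m/n≡0)
open import Data.Nat.Divisibility using (_∣_; divides; n∣m⇒m%n≡0; m%n≡0⇒n∣m; ∣⇒≤; 0∣⇒≡0; ∣m⇒∣m*n; >⇒∤; ∣1⇒≡1)
open import Data.Nat.Coprimality using (Coprime; coprime-divisor; prime⇒coprime; coprime-Bézout)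
open import Data.Nat.GCD using (module Bézout)
open import Data.Nat.Primality using (Prime; euclidsLemma; ¬prime[0]; ¬prime[1])
open import Data.Nat.ListAction using (product)
open import Data.Nat.Tactic.RingSolver using (solve-∀)
open import Data.Bool using (Bool; true; false; not; if_then_else_)
open import Data.Bool.Properties using (not-involutive) renaming (_≟_ to _≟ᵇ_)
open import Data.Fin
  using (Fin; zero; suc; toℕ; fromℕ<; _↑ˡ_; _↑ʳ_; splitAt; join; remQuot; combine; punchIn)
  renaming (_≟_ to _≟ᶠ_)
open import Data.Fin.Patterns using (0F; 1F; 2F; 3F)
open import Data.Fin.Properties
  using (+↔⊎; *↔×; splitAt-join; join-splitAt; splitAt-↑ˡ; splitAt-↑ʳ; remQuot-combine; combine-remQuot;
         combine-injective; toℕ-injective; toℕ-fromℕ<; toℕ<n; punchInᵢ≢i; any?; all?)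
open import Data.Fin.Permutation
  using (Permutation′; _⟨$⟩ʳ_; _⟨$⟩ˡ_; id; transpose; permutation)
import Data.Fin.Permutation as Perm
import Data.Fin.Subset
open import Data.Fin.Subset using (Subset; _∈_; _∉_; ∣_∣; inside; outside)
open import Data.Fin.Subset.Properties using (∈⊤; x∈p∧x≢y⇒x∈p-y; x∈p⇒∣p-x∣<∣p∣; p⊆q⇒∣p∣≤∣q∣; ∣⊤∣≡n; _∈?_)
open import Data.Vec using ([]; _∷_; _++_; take; drop)
open import Data.Vec.Base using (here; there)
open import Data.Vec.Properties using (take++drop≡id)
open import Data.Vec.Properties.WithK using ([]=-irrelevant)
open import Data.List using ([]; _∷_)
open import Data.List.Relation.Unary.All using (All; []; _∷_)
open import Data.Product using (Σ; ∃; ∃₂; _×_; _,_; proj₁; proj₂) renaming (map to ×-map)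
open import Data.Product.Function.NonDependent.Propositional using (_×-↔_)
open import Data.Sum using (_⊎_; inj₁; inj₂; [_,_]′) renaming (map to ⊎-map)
open import Data.Sum.Function.Propositional using (_⊎-↔_)
open import Data.Unit using (tt)
open import Data.Empty using (⊥-elim)
open import Function using (_∘_; _⟨_⟩_)
open import Function.Bundles using (_↔_; Injection; mk↔ₛ′)
open import Function.Properties.Inverse using (↔⇒↣)
open import Function.Construct.Composition using (_↔-∘_)
open import Function.Construct.Symmetry using (↔-sym)
open import Algebra.Properties.CommutativeMonoid.Sum +-0-commutativeMonoid
  using (sum; ∑-distrib-+; sum-permute; sum-remove; sum-cong-≗; sum-replicate-zero)
open import Relation.Nullary using (¬_; Dec; does; yes; no; map′; contradiction; _×-dec_; _⊎-dec_; _→-dec_)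
open import Relation.Nullary.Decidable using (True; toWitness; ¬?; decidable-stable; dec-true; dec-false)
open import Relation.Binary.Structures using (IsEquivalence)
open import Relation.Binary.PropositionalEquality
  using (_≡_; _≢_; refl; sym; trans; cong; cong₂; subst; module ≡-Reasoning)
import Relation.Binary.Reasoning.Setoid as SetoidReasoning

∣p++q∣ : ∀ {m n} (p : Subset m) (q : Subset n) → ∣ p ++ q ∣ ≡ ∣ p ∣ + ∣ q ∣
∣p++q∣ []            q = refl
∣p++q∣ (inside ∷ p)  q = cong suc (∣p++q∣ p q)
∣p++q∣ (outside ∷ p) q = ∣p++q∣ p q

∈-++⁺ˡ : ∀ {m n} {p : Subset m} (q : Subset n) {a} → a ∈ p → a ↑ˡ n ∈ p ++ q
∈-++⁺ˡ q here      = here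
∈-++⁺ˡ q (there h) = there (∈-++⁺ˡ q h)

∈-++⁻ˡ : ∀ {m n} (p : Subset m) (q : Subset n) {a} → a ↑ˡ n ∈ p ++ q → a ∈ p
∈-++⁻ˡ (_ ∷ p) q {zero}  here      = here
∈-++⁻ˡ (_ ∷ p) q {suc a} (there h) = there (∈-++⁻ˡ p q h)

∈-++⁺ʳ : ∀ {m n} (p : Subset m) {q : Subset n} {c} → c ∈ q → m ↑ʳ c ∈ p ++ q
∈-++⁺ʳ []      h = h
∈-++⁺ʳ (_ ∷ p) h = there (∈-++⁺ʳ p h)

∈-++⁻ʳ : ∀ {m n} (p : Subset m) (q : Subset n) {c} → m ↑ʳ c ∈ p ++ q → c ∈ q
∈-++⁻ʳ []      q h         = h
∈-++⁻ʳ (_ ∷ p) q (there h) = ∈-++⁻ʳ p q h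

module _ {m r : ℕ} (Kᶜ : Subset m) (Kᵉ : Subset r) where

  ∈-++⁻ : ∀ {u} → u ∈ Kᶜ ++ Kᵉ → [ _∈ Kᶜ , _∈ Kᵉ ]′ (splitAt m u)
  ∈-++⁻ {u} u∈K with splitAt m u | join-splitAt m r u
  ... | inj₁ a | refl = ∈-++⁻ˡ Kᶜ Kᵉ u∈K
  ... | inj₂ c | refl = ∈-++⁻ʳ Kᶜ Kᵉ u∈K

  ∈-++⁺ : ∀ s → [ _∈ Kᶜ , _∈ Kᵉ ]′ s → join m r s ∈ Kᶜ ++ Kᵉ
  ∈-++⁺ (inj₁ a) a∈Kᶜ = ∈-++⁺ˡ Kᵉ a∈Kᶜ
  ∈-++⁺ (inj₂ c) c∈Kᵉ = ∈-++⁺ʳ Kᶜ c∈Kᵉ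

two-missing⇒2+∣p∣≤n : ∀ {n} {p : Subset n} {x y} → x ≢ y → x ∉ p → y ∉ p → 2 + ∣ p ∣ ≤ n
two-missing⇒2+∣p∣≤n {n} {p} {x} {y} x≢y x∉p y∉p = begin-strict
  1 + ∣ p ∣             ≤⟨ s≤s (p⊆q⇒∣p∣≤∣q∣ p⊆⊤-x-y) ⟩
  1 + ∣ ⊤ {n} - x - y ∣ ≤⟨ x∈p⇒∣p-x∣<∣p∣ (x∈p∧x≢y⇒x∈p-y (∈⊤ {x = y}) (x≢y ∘ sym)) ⟩
  ∣ ⊤ {n} - x ∣         <⟨ x∈p⇒∣p-x∣<∣p∣ (∈⊤ {x = x}) ⟩
  ∣ ⊤ {n} ∣             ≡⟨ ∣⊤∣≡n n ⟩
  n                     ∎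
  where
  open ≤-Reasoning
  open Data.Fin.Subset using (⊤; _-_)
  p⊆⊤-x-y : ∀ {z} → z ∈ p → z ∈ ⊤ - x - y
  p⊆⊤-x-y z∈p = x∈p∧x≢y⇒x∈p-y (x∈p∧x≢y⇒x∈p-y ∈⊤ λ { refl → x∉p z∈p }) λ { refl → y∉p z∈p }

only-missing : ∀ {n} (p : Subset n) → n ≤ suc ∣ p ∣ → ∀ {x} → x ∉ p → ∀ y → y ≢ x → y ∈ p
only-missing p n≤1+∣p∣ x∉p y y≢x with y ∈? p
... | yes y∈p = y∈p
... | no  y∉p = ⊥-elim (1+n≰n (≤-trans (two-missing⇒2+∣p∣≤n y≢x y∉p x∉p) n≤1+∣p∣))

allSubsets? : ∀ {n} {P : Subset n → Set} → (∀ p → Dec (P p)) → Dec (∀ p → P p)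
allSubsets? {zero}  P? = map′ (λ { P[] [] → P[] }) (λ ∀P → ∀P []) (P? [])
allSubsets? {suc n} P? =
  map′ (λ { (∀P-in , ∀P-out) (inside ∷ p) → ∀P-in p ; (∀P-in , ∀P-out) (outside ∷ p) → ∀P-out p })
       (λ ∀P → (λ p → ∀P (inside ∷ p)) , (λ p → ∀P (outside ∷ p)))
       (allSubsets? (λ p → P? (inside ∷ p)) ×-dec allSubsets? (λ p → P? (outside ∷ p)))

record Stabilises {n} (π : Permutation′ n) (K : Subset n) : Set where
  field
    ⟨$⟩ʳ-∈ : ∀ {u} → u ∈ K → π ⟨$⟩ʳ u ∈ K
    ⟨$⟩ˡ-∈ : ∀ {u} → u ∈ K → π ⟨$⟩ˡ u ∈ K
open Stabilises

id-stabilises : ∀ {n} {K : Subset n} → Stabilises id K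
id-stabilises = record { ⟨$⟩ʳ-∈ = λ u∈K → u∈K ; ⟨$⟩ˡ-∈ = λ u∈K → u∈K }

fixing-stabilises : ∀ {n} (π : Permutation′ n) {p : Subset n} {x} → π ⟨$⟩ʳ x ≡ x →
  (∀ y → y ≢ x → y ∈ p) → Stabilises π p
fixing-stabilises π {p} {x} πx≡x p⊇∁x = record
  { ⟨$⟩ʳ-∈ = ∈-unless-x λ πu≡x → trans πu≡x (sym (Injection.injective (↔⇒↣ π) (trans πu≡x (sym πx≡x))))
  ; ⟨$⟩ˡ-∈ = ∈-unless-x λ π⁻¹u≡x →
      trans π⁻¹u≡x (trans (sym πx≡x) (trans (cong (π ⟨$⟩ʳ_) (sym π⁻¹u≡x)) (Perm.inverseʳ π))) }
  where
  ∈-unless-x : ∀ {w u} → (w ≡ x → w ≡ u) → u ∈ p → w ∈ p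
  ∈-unless-x {w} w≡x⇒w≡u u∈p with w ≟ᶠ x
  ... | yes w≡x = subst (_∈ p) (sym (w≡x⇒w≡u w≡x)) u∈p
  ... | no  w≢x = p⊇∁x w w≢x

_⊕_ : ∀ {m r} → Permutation′ m → Permutation′ r → Permutation′ (m + r)
α ⊕ ρ = ↔-sym +↔⊎ ↔-∘ ((α ⊎-↔ ρ) ↔-∘ +↔⊎)

splitAt-⊕ : ∀ {m r} (α : Permutation′ m) (ρ : Permutation′ r) u →
  splitAt m ((α ⊕ ρ) ⟨$⟩ʳ u) ≡ ⊎-map (α ⟨$⟩ʳ_) (ρ ⟨$⟩ʳ_) (splitAt m u)
splitAt-⊕ {m} {r} α ρ u = splitAt-join m r _

stabilises-⊕ : ∀ {m r} {Kᶜ : Subset m} {Kᵉ : Subset r} {α ρ} →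
  Stabilises α Kᶜ → Stabilises ρ Kᵉ → Stabilises (α ⊕ ρ) (Kᶜ ++ Kᵉ)
stabilises-⊕ {m} {r} {Kᶜ} {Kᵉ} α-st ρ-st = record
  { ⟨$⟩ʳ-∈ = ⊕-∈ (⟨$⟩ʳ-∈ α-st) (⟨$⟩ʳ-∈ ρ-st)
  ; ⟨$⟩ˡ-∈ = ⊕-∈ (⟨$⟩ˡ-∈ α-st) (⟨$⟩ˡ-∈ ρ-st) }
  where
  ⊕-∈ : ∀ {f g} → (∀ {a} → a ∈ Kᶜ → f a ∈ Kᶜ) → (∀ {c} → c ∈ Kᵉ → g c ∈ Kᵉ) →
    ∀ {u} → u ∈ Kᶜ ++ Kᵉ → join m r (⊎-map f g (splitAt m u)) ∈ Kᶜ ++ Kᵉ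
  ⊕-∈ {f} {g} f-∈ g-∈ {u} u∈K =
    ∈-++⁺ Kᶜ Kᵉ (⊎-map f g (splitAt m u)) (map-∈ (splitAt m u) (∈-++⁻ Kᶜ Kᵉ u∈K))
    where
    map-∈ : ∀ s → [ _∈ Kᶜ , _∈ Kᵉ ]′ s → [ _∈ Kᶜ , _∈ Kᵉ ]′ (⊎-map f g s)
    map-∈ (inj₁ a) = f-∈
    map-∈ (inj₂ c) = g-∈

restrict : ∀ {n} (π : Permutation′ n) {K : Subset n} → Stabilises π K → Elt K ↔ Elt K
restrict π π-st = mk↔ₛ′ (λ (u , u∈K) → π ⟨$⟩ʳ u , ⟨$⟩ʳ-∈ π-st u∈K)
                        (λ (u , u∈K) → π ⟨$⟩ˡ u , ⟨$⟩ˡ-∈ π-st u∈K)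
                        (λ _ → Elt-≡ (Perm.inverseʳ π))
                        (λ _ → Elt-≡ (Perm.inverseˡ π))
  where
  Elt-≡ : ∀ {K : Subset _} {u w} {u∈K : u ∈ K} {w∈K : w ∈ K} → u ≡ w → (u , u∈K) ≡ (w , w∈K)
  Elt-≡ refl = cong (_ ,_) ([]=-irrelevant _ _)

isoInduced : ∀ {n} {G H : Graph n} {K : Subset n} (π : Permutation′ n) → Stabilises π K →
  (∀ {u w} → u ∈ K → w ∈ K → adj H (π ⟨$⟩ʳ u) (π ⟨$⟩ʳ w) ≡ adj G u w) → IsoInduced G H K
isoInduced π π-st iso = restrict π π-st , λ (u , u∈K) (w , w∈K) → sym (iso u∈K w∈K)

isoInduced-respʳ : ∀ {n} {G H H′ : Graph n} {K : Subset n} →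
  SameGraph H H′ → IsoInduced G H K → IsoInduced G H′ K
isoInduced-respʳ H≡H′ (f , iso) = f , λ a b → trans (iso a b) (H≡H′ _ _)

record IsIsomorphism {n} (G H : Graph n) (π : Permutation′ n) : Set where
  field preserves : ∀ a b → adj H (π ⟨$⟩ʳ a) (π ⟨$⟩ʳ b) ≡ adj G a b

record IsAntimorphism {n} (G : Graph n) (π : Permutation′ n) : Set where
  field flips : ∀ a b → a ≢ b → adj G (π ⟨$⟩ʳ a) (π ⟨$⟩ʳ b) ≡ not (adj G a b)

id-isomorphism : ∀ {n} {G : Graph n} → IsIsomorphism G G id
id-isomorphism = record { preserves = λ _ _ → refl }

complement-adj-≢ : ∀ {n} (G : Graph n) {x y} → x ≢ y → adj (complement G) x y ≡ not (adj G x y)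
complement-adj-≢ G {x} {y} x≢y with x ≟ᶠ y
... | yes x≡y = ⊥-elim (x≢y x≡y)
... | no  _   = refl

antimorphism⇒isomorphism : ∀ {n} {G : Graph n} {π} → IsAntimorphism G π → IsIsomorphism G (complement G) π
antimorphism⇒isomorphism {G = G} {π} anti = record { preserves = preserves }
  where
  preserves : ∀ a b → adj (complement G) (π ⟨$⟩ʳ a) (π ⟨$⟩ʳ b) ≡ adj G a b
  preserves a b with a ≟ᶠ b
  ... | yes refl = trans (adj-irrefl (complement G) (π ⟨$⟩ʳ a)) (sym (adj-irrefl G a))
  ... | no  a≢b  = begin
    adj (complement G) (π ⟨$⟩ʳ a) (π ⟨$⟩ʳ b) ≡⟨ complement-adj-≢ G (a≢b ∘ Injection.injective (↔⇒↣ π)) ⟩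
    not (adj G (π ⟨$⟩ʳ a) (π ⟨$⟩ʳ b))       ≡⟨ cong not (IsAntimorphism.flips anti a b a≢b) ⟩
    not (not (adj G a b))                   ≡⟨ not-involutive _ ⟩
    adj G a b                               ∎
    where open ≡-Reasoning

record FixingAntimorphisms (m : ℕ) : Set where
  field
    graph            : Graph m
    antimorphism     : Fin m → Permutation′ m
    antimorphism-fix : ∀ x → antimorphism x ⟨$⟩ʳ x ≡ x
    isAntimorphism   : ∀ x → IsAntimorphism graph (antimorphism x)

someAntimorphism : ∀ {m} (S : FixingAntimorphisms m) →
  Σ (Permutation′ m) (IsAntimorphism (FixingAntimorphisms.graph S))
someAntimorphism {zero}  S = id , record { flips = λ () }
someAntimorphism {suc m} S = antimorphism zero , isAntimorphism zero
  where open FixingAntimorphisms S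

stabilisingAntimorphism : ∀ {m} (S : FixingAntimorphisms m) (p : Subset m) → m ≤ suc ∣ p ∣ →
  Σ (Permutation′ m) λ α → IsAntimorphism (FixingAntimorphisms.graph S) α × Stabilises α p
stabilisingAntimorphism S p m≤1+∣p∣ with any? (λ x → ¬? (x ∈? p))
... | yes (x , x∉p) = antimorphism x , isAntimorphism x ,
        fixing-stabilises (antimorphism x) (antimorphism-fix x) (only-missing p m≤1+∣p∣ x∉p)
  where open FixingAntimorphisms S
... | no  ∄x∉p = let α , α-anti = someAntimorphism S in
        α , α-anti , record { ⟨$⟩ʳ-∈ = λ _ → everything-∈ _ ; ⟨$⟩ˡ-∈ = λ _ → everything-∈ _ }
  where
  everything-∈ : ∀ y → y ∈ p
  everything-∈ y = decidable-stable (y ∈? p) (λ y∉p → ∄x∉p (y , y∉p))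

-- Extending a core graph by extra vertices

extendAdj : ∀ {m r} → Graph m → (Fin r → Bool) → Graph r → Fin m ⊎ Fin r → Fin m ⊎ Fin r → Bool
extendAdj P t H (inj₁ a) (inj₁ b) = adj P a b
extendAdj P t H (inj₁ a) (inj₂ c) = t c
extendAdj P t H (inj₂ c) (inj₁ a) = t c
extendAdj P t H (inj₂ c) (inj₂ d) = adj H c d

extend : ∀ {m r} → Graph m → (Fin r → Bool) → Graph r → Graph (m + r)
extend {m} P t H = record
  { adj        = λ u w → extendAdj P t H (splitAt m u) (splitAt m w)
  ; adj-sym    = λ u w → sym-⊎ (splitAt m u) (splitAt m w)
  ; adj-irrefl = λ u → irrefl-⊎ (splitAt m u) }
  where
  sym-⊎ : ∀ s s′ → extendAdj P t H s s′ ≡ extendAdj P t H s′ s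
  sym-⊎ (inj₁ a) (inj₁ b) = adj-sym P a b
  sym-⊎ (inj₁ a) (inj₂ c) = refl
  sym-⊎ (inj₂ c) (inj₁ a) = refl
  sym-⊎ (inj₂ c) (inj₂ d) = adj-sym H c d
  irrefl-⊎ : ∀ s → extendAdj P t H s s ≡ false
  irrefl-⊎ (inj₁ a) = adj-irrefl P a
  irrefl-⊎ (inj₂ c) = adj-irrefl H c

record Matching {r} (t : Fin r → Bool) (H : Graph r) (t′ : Fin r → Bool) (H′ : Graph r)
                (v : Subset r) (ρ : Permutation′ r) : Set where
  field
    stabilises : Stabilises ρ v
    link       : ∀ {c} → c ∈ v → t′ (ρ ⟨$⟩ʳ c) ≡ t c
    edge       : ∀ {c d} → c ∈ v → d ∈ v → adj H′ (ρ ⟨$⟩ʳ c) (ρ ⟨$⟩ʳ d) ≡ adj H c d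

extend-isoInduced : ∀ {m r} {P Q : Graph m} {t t′ H H′} {Kᶜ : Subset m} {Kᵉ : Subset r} {α ρ} →
  IsIsomorphism P Q α → Stabilises α Kᶜ → Matching t H t′ H′ Kᵉ ρ →
  IsoInduced (extend P t H) (extend Q t′ H′) (Kᶜ ++ Kᵉ)
extend-isoInduced {m} {r} {P} {Q} {t} {t′} {H} {H′} {Kᶜ} {Kᵉ} {α} {ρ} α-iso α-st M =
  isoInduced {G = extend P t H} {H = extend Q t′ H′} (α ⊕ ρ) (stabilises-⊕ α-st stabilises)
    λ {u} {w} u∈K w∈K →
      trans (cong₂ (extendAdj Q t′ H′) (splitAt-⊕ α ρ u) (splitAt-⊕ α ρ w))
            (iso-⊎ (splitAt m u) (splitAt m w) (∈-++⁻ Kᶜ Kᵉ u∈K) (∈-++⁻ Kᶜ Kᵉ w∈K))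
  where
  open Matching M
  iso-⊎ : ∀ s s′ → [ _∈ Kᶜ , _∈ Kᵉ ]′ s → [ _∈ Kᶜ , _∈ Kᵉ ]′ s′ →
    extendAdj Q t′ H′ (⊎-map (α ⟨$⟩ʳ_) (ρ ⟨$⟩ʳ_) s) (⊎-map (α ⟨$⟩ʳ_) (ρ ⟨$⟩ʳ_) s′) ≡ extendAdj P t H s s′
  iso-⊎ (inj₁ a) (inj₁ b) _   _   = IsIsomorphism.preserves α-iso a b
  iso-⊎ (inj₁ a) (inj₂ c) _   c∈v = link c∈v
  iso-⊎ (inj₂ c) (inj₁ a) c∈v _   = link c∈v
  iso-⊎ (inj₂ c) (inj₂ d) c∈v d∈v = edge c∈v d∈v

extend-complement : ∀ {m r} (P : Graph m) t (H : Graph r) →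
  SameGraph (extend (complement P) (not ∘ t) (complement H)) (complement (extend P t H))
extend-complement {m} {r} P t H u w with u ≟ᶠ w
... | yes refl = adj-irrefl (extend (complement P) (not ∘ t) (complement H)) u
... | no  u≢w  = complement-⊎ (splitAt m u) (splitAt m w) λ su≡sw →
                   u≢w (trans (sym (join-splitAt m r u)) (trans (cong (join m r) su≡sw) (join-splitAt m r w)))
  where
  complement-⊎ : ∀ s s′ → s ≢ s′ →
    extendAdj (complement P) (not ∘ t) (complement H) s s′ ≡ not (extendAdj P t H s s′)
  complement-⊎ (inj₁ a) (inj₁ b) s≢s′ = complement-adj-≢ P λ { refl → s≢s′ refl }
  complement-⊎ (inj₁ a) (inj₂ c) _    = refl
  complement-⊎ (inj₂ c) (inj₁ a) _    = refl
  complement-⊎ (inj₂ c) (inj₂ d) s≢s′ = complement-adj-≢ H λ { refl → s≢s′ refl }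

module _ {m r} {P Q : Graph m} {t t′ : Fin r → Bool} {H H′ : Graph r}
         (same : SameGraph (extend P t H) (extend Q t′ H′)) where

  sameGraph-extra : SameGraph H H′
  sameGraph-extra c d = begin
    adj H c d                              ≡⟨ cong₂ (extendAdj P t H) (splitAt-↑ʳ m r c) (splitAt-↑ʳ m r d) ⟨
    adj (extend P t H) (m ↑ʳ c) (m ↑ʳ d)   ≡⟨ same (m ↑ʳ c) (m ↑ʳ d) ⟩
    adj (extend Q t′ H′) (m ↑ʳ c) (m ↑ʳ d) ≡⟨ cong₂ (extendAdj Q t′ H′) (splitAt-↑ʳ m r c) (splitAt-↑ʳ m r d) ⟩
    adj H′ c d                             ∎
    where open ≡-Reasoning

  sameGraph-link : Fin m → ∀ c → t c ≡ t′ c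
  sameGraph-link a c = begin
    t c                                    ≡⟨ cong₂ (extendAdj P t H) (splitAt-↑ˡ m a r) (splitAt-↑ʳ m r c) ⟨
    adj (extend P t H) (a ↑ˡ r) (m ↑ʳ c)   ≡⟨ same (a ↑ˡ r) (m ↑ʳ c) ⟩
    adj (extend Q t′ H′) (a ↑ˡ r) (m ↑ʳ c) ≡⟨ cong₂ (extendAdj Q t′ H′) (splitAt-↑ˡ m a r) (splitAt-↑ʳ m r c) ⟩
    t′ c                                   ∎
    where open ≡-Reasoning

-- Complementing matchings are only allowed on sets v with ∣ v ∣ + slack ≤ r + 1: then a set K with
-- extra part v and |K| + slack ≥ m + r misses at most one core vertex, so that some antimorphism of
-- the core stabilises the core part of K.
Matches : ∀ {r} → (Fin r → Bool) → Graph r → (Fin r → Bool) → Graph r → ℕ → Subset r → Set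
Matches {r} t H t′ H′ slack v =
  (∃ λ ρ → Matching t H t′ H′ v ρ) ⊎
  (∣ v ∣ + slack ≤ suc r × ∃ λ ρ → Matching t H (not ∘ t′) (complement H′) v ρ)

record ExtensionPair (r : ℕ) : Set where
  field
    link link′          : Fin r → Bool
    graph graph′        : Graph r
    slack               : ℕ
    matches             : ∀ v → Matches link graph link′ graph′ slack v
    distinct            : (∃ λ c → link′ c ≢ link c) ⊎ ¬ SameGraph graph′ graph
    distinct-complement : ¬ SameGraph graph′ (complement graph)

module _ {m r} (S : FixingAntimorphisms m) (E : ExtensionPair r) where
  open FixingAntimorphisms S using () renaming (graph to P)
  open ExtensionPair E

  G G′ : Graph (m + r)
  G  = extend P link graph
  G′ = extend P link′ graph′

  core-almost-full : ∀ (Kᶜ : Subset m) (Kᵉ : Subset r) →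
    m + r ≤ ∣ Kᶜ ++ Kᵉ ∣ + slack → ∣ Kᵉ ∣ + slack ≤ suc r → m ≤ suc ∣ Kᶜ ∣
  core-almost-full Kᶜ Kᵉ large small = +-cancelʳ-≤ r m (suc ∣ Kᶜ ∣) (begin
    m + r                     ≤⟨ large ⟩
    ∣ Kᶜ ++ Kᵉ ∣ + slack      ≡⟨ cong (_+ slack) (∣p++q∣ Kᶜ Kᵉ) ⟩
    ∣ Kᶜ ∣ + ∣ Kᵉ ∣ + slack   ≡⟨ +-assoc ∣ Kᶜ ∣ ∣ Kᵉ ∣ slack ⟩
    ∣ Kᶜ ∣ + (∣ Kᵉ ∣ + slack) ≤⟨ +-monoʳ-≤ ∣ Kᶜ ∣ small ⟩
    ∣ Kᶜ ∣ + suc r            ≡⟨ +-suc ∣ Kᶜ ∣ r ⟩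
    suc ∣ Kᶜ ∣ + r            ∎)
    where open ≤-Reasoning

  isoUpToCompl-++ : ∀ Kᶜ Kᵉ → m + r ≤ ∣ Kᶜ ++ Kᵉ ∣ + slack → IsoUpToComplInduced G G′ (Kᶜ ++ Kᵉ)
  isoUpToCompl-++ Kᶜ Kᵉ large with matches Kᵉ
  ... | inj₁ (ρ , M) = inj₁ (extend-isoInduced id-isomorphism id-stabilises M)
  ... | inj₂ (small , ρ , M) with stabilisingAntimorphism S Kᶜ (core-almost-full Kᶜ Kᵉ large small)
  ...   | α , α-anti , α-st =
    inj₂ (isoInduced-respʳ {G = G} {H = extend (complement P) (not ∘ link′) (complement graph′)}
            {H′ = complement G′} (extend-complement P link′ graph′)
            (extend-isoInduced (antimorphism⇒isomorphism α-anti) α-st M))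

  hypomorphic : ∀ k → m + r ≤ k + slack → HypomorphicUpToCompl k G G′
  hypomorphic k bound K refl = subst (IsoUpToComplInduced G G′) split≡K
    (isoUpToCompl-++ (take m K) (drop m K) (subst (λ K → m + r ≤ ∣ K ∣ + slack) (sym split≡K) bound))
    where
    split≡K : take m K ++ drop m K ≡ K
    split≡K = take++drop≡id m K

  distinct-extensions : Fin m → ¬ SameGraph G′ G
  distinct-extensions a same with distinct
  ... | inj₁ (c , link′c≢linkc) = link′c≢linkc (sameGraph-link same a c)
  ... | inj₂ graph′≢graph       = graph′≢graph (sameGraph-extra same)

  distinct-complement-extensions : ¬ SameGraph G′ (complement G)
  distinct-complement-extensions same = distinct-complement (sameGraph-extra {Q = complement P} λ u w →
    trans (same u w) (sym (extend-complement P link graph u w)))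

-- The extension pairs for r = 2, 3, 4

module _ {r} (t : Fin r → Bool) (H : Graph r) (t′ : Fin r → Bool) (H′ : Graph r) (v : Subset r) where

  matching? : ∀ ρ → Dec (Matching t H t′ H′ v ρ)
  matching? ρ = map′
    (λ { ((⟨$⟩ʳ-∈ , ⟨$⟩ˡ-∈) , link , edge) → record
      { stabilises = record { ⟨$⟩ʳ-∈ = ⟨$⟩ʳ-∈ _ ; ⟨$⟩ˡ-∈ = ⟨$⟩ˡ-∈ _ } ; link = link _ ; edge = edge _ _ } })
    (λ M → let open Matching M in
      ((λ _ → ⟨$⟩ʳ-∈ stabilises) , (λ _ → ⟨$⟩ˡ-∈ stabilises)) , (λ _ → link) , λ _ _ → edge)
    (((all? λ c → c ∈? v →-dec ρ ⟨$⟩ʳ c ∈? v) ×-dec (all? λ c → c ∈? v →-dec ρ ⟨$⟩ˡ c ∈? v)) ×-dec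
     (all? λ c → c ∈? v →-dec t′ (ρ ⟨$⟩ʳ c) ≟ᵇ t c) ×-dec
     (all? λ c → all? λ d → c ∈? v →-dec d ∈? v →-dec adj H′ (ρ ⟨$⟩ʳ c) (ρ ⟨$⟩ʳ d) ≟ᵇ adj H c d))

  matchingTransposition? : Dec (∃₂ λ i j → Matching t H t′ H′ v (transpose i j))
  matchingTransposition? = any? λ i → any? λ j → matching? (transpose i j)

TranspositionMatches : ∀ {r} → (Fin r → Bool) → Graph r → (Fin r → Bool) → Graph r → ℕ → Subset r → Set
TranspositionMatches {r} t H t′ H′ slack v =
  (∃₂ λ i j → Matching t H t′ H′ v (transpose i j)) ⊎
  (∣ v ∣ + slack ≤ suc r × ∃₂ λ i j → Matching t H (not ∘ t′) (complement H′) v (transpose i j))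

transpositionMatches? : ∀ {r} t H t′ H′ slack (v : Subset r) → Dec (TranspositionMatches t H t′ H′ slack v)
transpositionMatches? {r} t H t′ H′ slack v =
  matchingTransposition? t H t′ H′ v ⊎-dec
  (∣ v ∣ + slack ≤? suc r) ×-dec matchingTransposition? t H (not ∘ t′) (complement H′) v

checkedExtensionPair : ∀ {r} (t t′ : Fin r → Bool) (H H′ : Graph r) slack →
  True (allSubsets? (transpositionMatches? t H t′ H′ slack)) →
  (∃ (λ c → t′ c ≢ t c) ⊎ ¬ SameGraph H′ H) → ¬ SameGraph H′ (complement H) → ExtensionPair r
checkedExtensionPair t t′ H H′ slack check distinct distinct-complement = record
  { link = t ; link′ = t′ ; graph = H ; graph′ = H′ ; slack = slack
  ; matches = λ v → byTransposition (toWitness check v)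
  ; distinct = distinct ; distinct-complement = distinct-complement }
  where
  byTransposition : ∀ {v} → TranspositionMatches t H t′ H′ slack v → Matches t H t′ H′ slack v
  byTransposition (inj₁ (i , j , M))         = inj₁ (transpose i j , M)
  byTransposition (inj₂ (small , i , j , M)) = inj₂ (small , transpose i j , M)

tableGraph : ∀ {r} (A : Fin r → Fin r → Bool) →
  True (all? λ c → all? λ d → A c d ≟ᵇ A d c) → True (all? λ c → A c c ≟ᵇ false) → Graph r
tableGraph A symmetric irreflexive =
  record { adj = A ; adj-sym = toWitness symmetric ; adj-irrefl = toWitness irreflexive }

extensionPair₂ : ExtensionPair 2
extensionPair₂ = checkedExtensionPair t (not ∘ t) H H 2 tt
  (inj₁ (0F , λ ())) λ same → contradiction (same 0F 1F) λ ()
  where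
  t : Fin 2 → Bool
  t 0F = false
  t 1F = true
  H : Graph 2
  H = tableGraph (λ _ _ → false) tt tt

extensionPair₃ : ExtensionPair 3
extensionPair₃ = checkedExtensionPair t t (tableGraph H tt tt) (tableGraph H′ tt tt) 2 tt
  (inj₂ λ same → contradiction (same 0F 2F) λ ()) λ same → contradiction (same 0F 1F) λ ()
  where
  t : Fin 3 → Bool
  t 2F = true
  t _  = false
  H H′ : Fin 3 → Fin 3 → Bool
  H 1F 2F = true
  H 2F 1F = true
  H _  _  = false
  H′ 0F 2F = true
  H′ 2F 0F = true
  H′ _  _  = false

extensionPair₄ : ExtensionPair 4
extensionPair₄ = checkedExtensionPair t t (tableGraph H tt tt) (tableGraph H′ tt tt) 3 tt
  (inj₂ λ same → contradiction (same 0F 2F) λ ()) λ same → contradiction (same 0F 1F) λ ()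
  where
  t : Fin 4 → Bool
  t 2F = true
  t 3F = true
  t _  = false
  H H′ : Fin 4 → Fin 4 → Bool
  H 0F 3F = true
  H 3F 0F = true
  H 1F 2F = true
  H 2F 1F = true
  H _  _  = false
  H′ 0F 2F = true
  H′ 2F 0F = true
  H′ 1F 3F = true
  H′ 3F 1F = true
  H′ _  _  = false

-- Lexicographic products

singleVertex : FixingAntimorphisms 1
singleVertex = record
  { graph            = record { adj = λ _ _ → false ; adj-sym = λ _ _ → refl ; adj-irrefl = λ _ → refl }
  ; antimorphism     = λ _ → id
  ; antimorphism-fix = λ _ → refl
  ; isAntimorphism   = λ _ → record { flips = λ { zero zero 0≢0 → ⊥-elim (0≢0 refl) } } }

module _ {a b : ℕ} where

  lexAdj : Graph a → Graph b → Fin a × Fin b → Fin a × Fin b → Bool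
  lexAdj G H (i , j) (i′ , j′) with i ≟ᶠ i′
  ... | yes _ = adj H j j′
  ... | no  _ = adj G i i′

  lexicographic : Graph a → Graph b → Graph (a * b)
  lexicographic G H = record
    { adj        = λ u w → lexAdj G H (remQuot {a} b u) (remQuot {a} b w)
    ; adj-sym    = λ u w → sym-× (remQuot {a} b u) (remQuot {a} b w)
    ; adj-irrefl = λ u → irrefl-× (remQuot {a} b u) }
    where
    sym-× : ∀ p q → lexAdj G H p q ≡ lexAdj G H q p
    sym-× (i , j) (i′ , j′) with i ≟ᶠ i′ | i′ ≟ᶠ i
    ... | yes _    | yes _    = adj-sym H j j′
    ... | yes refl | no  i≢i  = ⊥-elim (i≢i refl)
    ... | no  i≢i  | yes refl = ⊥-elim (i≢i refl)
    ... | no  _    | no  _    = adj-sym G i i′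
    irrefl-× : ∀ p → lexAdj G H p p ≡ false
    irrefl-× (i , j) with i ≟ᶠ i
    ... | yes _   = adj-irrefl H j
    ... | no  i≢i = ⊥-elim (i≢i refl)

  _⊗_ : Permutation′ a → Permutation′ b → Permutation′ (a * b)
  α ⊗ β = ↔-sym *↔× ↔-∘ ((α ×-↔ β) ↔-∘ *↔×)

  remQuot-⊗ : ∀ (α : Permutation′ a) (β : Permutation′ b) u →
    remQuot {a} b ((α ⊗ β) ⟨$⟩ʳ u) ≡ ×-map (α ⟨$⟩ʳ_) (β ⟨$⟩ʳ_) (remQuot {a} b u)
  remQuot-⊗ α β u = remQuot-combine (α ⟨$⟩ʳ proj₁ (remQuot {a} b u)) (β ⟨$⟩ʳ proj₂ (remQuot {a} b u))

  lexicographic-antimorphism : ∀ {G : Graph a} {H : Graph b} {α β} →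
    IsAntimorphism G α → IsAntimorphism H β → IsAntimorphism (lexicographic G H) (α ⊗ β)
  lexicographic-antimorphism {G} {H} {α} {β} α-anti β-anti = record { flips = λ u w u≢w →
    trans (cong₂ (lexAdj G H) (remQuot-⊗ α β u) (remQuot-⊗ α β w))
          (flips-× (remQuot {a} b u) (remQuot {a} b w) (u≢w ∘ Injection.injective (↔⇒↣ (*↔× {a} {b})))) }
    where
    flips-× : ∀ p q → p ≢ q →
      lexAdj G H (×-map (α ⟨$⟩ʳ_) (β ⟨$⟩ʳ_) p) (×-map (α ⟨$⟩ʳ_) (β ⟨$⟩ʳ_) q) ≡ not (lexAdj G H p q)
    flips-× (i , j) (i′ , j′) p≢q with i ≟ᶠ i′ | α ⟨$⟩ʳ i ≟ᶠ α ⟨$⟩ʳ i′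
    ... | yes refl | yes _      = IsAntimorphism.flips β-anti j j′ λ { refl → p≢q refl }
    ... | yes refl | no  αi≢αi  = ⊥-elim (αi≢αi refl)
    ... | no  i≢i′ | yes αi≡αi′ = ⊥-elim (i≢i′ (Injection.injective (↔⇒↣ α) αi≡αi′))
    ... | no  i≢i′ | no  _      = IsAntimorphism.flips α-anti i i′ i≢i′

lexicographicFixing : ∀ {a b} → FixingAntimorphisms a → FixingAntimorphisms b → FixingAntimorphisms (a * b)
lexicographicFixing {a} {b} S T = record
  { graph            = lexicographic S.graph T.graph
  ; antimorphism     = λ u → let (x , y) = remQuot {a} b u in S.antimorphism x ⊗ T.antimorphism y
  ; antimorphism-fix = λ u →
      trans (cong₂ combine (S.antimorphism-fix _) (T.antimorphism-fix _)) (combine-remQuot {a} b u)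
  ; isAntimorphism   = λ u → lexicographic-antimorphism (S.isAntimorphism _) (T.isAntimorphism _) }
  where
  module S = FixingAntimorphisms S
  module T = FixingAntimorphisms T

powerFixing : ∀ {a} → FixingAntimorphisms a → ∀ e → FixingAntimorphisms (a ^ e)
powerFixing S zero    = singleVertex
powerFixing S (suc e) = lexicographicFixing S (powerFixing S e)

-- Paley-type graphs on finite ℤ[i]-modules

n<ᵇn : ∀ n → (n <ᵇ n) ≡ false
n<ᵇn zero    = refl
n<ᵇn (suc n) = n<ᵇn n

<ᵇ-flip : ∀ m n → m ≢ n → (n <ᵇ m) ≡ not (m <ᵇ n)
<ᵇ-flip zero    zero    0≢0 = ⊥-elim (0≢0 refl)
<ᵇ-flip zero    (suc n) _   = refl
<ᵇ-flip (suc m) zero    _   = refl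
<ᵇ-flip (suc m) (suc n) m≢n = <ᵇ-flip m n (m≢n ∘ cong suc)

-- A finite ℤ[i]-module without 2-torsion: J is multiplication by i, and index identifies the
-- carrier, up to ≈, with Fin N.
record GaussianModule (N : ℕ) : Set₁ where
  field
    additiveGroup : AbelianGroup 0ℓ 0ℓ
  open AbelianGroup additiveGroup
  field
    J               : Carrier → Carrier
    J-cong          : ∀ {x y} → x ≈ y → J x ≈ J y
    J-homo          : ∀ x y → J (x ∙ y) ≈ J x ∙ J y
    J-J             : ∀ x → J (J x) ≈ x ⁻¹
    no-2-torsion    : ∀ {x} → x ≈ x ⁻¹ → x ≈ ε
    index           : Carrier → Fin N
    element         : Fin N → Carrier
    index-cong      : ∀ {x y} → x ≈ y → index x ≡ index y
    index-injective : ∀ {x y} → index x ≡ index y → x ≈ y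
    index-element   : ∀ i → index (element i) ≡ i

module GaussianPaley {N} (M : GaussianModule N) where
  open GaussianModule M
  open AbelianGroup additiveGroup renaming (refl to ≈-refl; sym to ≈-sym; trans to ≈-trans)
  open AbelianGroupProperties additiveGroup
  open CommutativeSemigroupProperties commutativeSemigroup using (interchange)

  J-ε : J ε ≈ ε
  J-ε = ∙-cancelʳ (J ε) (J ε) ε (begin
    J ε ∙ J ε  ≈⟨ J-homo ε ε ⟨
    J (ε ∙ ε)  ≈⟨ J-cong (identityˡ ε) ⟩
    J ε        ≈⟨ identityˡ (J ε) ⟨
    ε ∙ J ε    ∎)
    where open SetoidReasoning setoid

  J-⁻¹ : ∀ x → J (x ⁻¹) ≈ J x ⁻¹
  J-⁻¹ x = inverseʳ-unique (J x) (J (x ⁻¹)) (begin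
    J x ∙ J (x ⁻¹) ≈⟨ J-homo x (x ⁻¹) ⟨
    J (x ∙ x ⁻¹)   ≈⟨ J-cong (inverseʳ x) ⟩
    J ε            ≈⟨ J-ε ⟩
    ε              ∎)
    where open SetoidReasoning setoid

  J-J-⁻¹ : ∀ x → J (J x) ⁻¹ ≈ x
  J-J-⁻¹ x = ≈-trans (⁻¹-cong (J-J x)) (⁻¹-involutive x)

  J-moves : ∀ {x} → ¬ x ≈ ε → ¬ (J x ≈ x ⊎ J x ≈ x ⁻¹)
  J-moves {x} x≉ε (inj₁ Jx≈x) = x≉ε (no-2-torsion (begin
    x         ≈⟨ Jx≈x ⟨
    J x       ≈⟨ J-cong Jx≈x ⟨
    J (J x)   ≈⟨ J-J x ⟩
    x ⁻¹      ∎))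
    where open SetoidReasoning setoid
  J-moves {x} x≉ε (inj₂ Jx≈x⁻¹) = x≉ε (no-2-torsion (begin
    x            ≈⟨ J-J-⁻¹ x ⟨
    J (J x) ⁻¹   ≈⟨ ⁻¹-cong (J-cong Jx≈x⁻¹) ⟩
    J (x ⁻¹) ⁻¹  ≈⟨ ⁻¹-cong (J-⁻¹ x) ⟩
    J x ⁻¹ ⁻¹    ≈⟨ ⁻¹-involutive (J x) ⟩
    J x          ≈⟨ Jx≈x⁻¹ ⟩
    x ⁻¹         ∎))
    where open SetoidReasoning setoid

  element-index : ∀ x → element (index x) ≈ x
  element-index x = index-injective (index-element (index x))

  key : Carrier → ℕ
  key x = toℕ (index x) ⊓ toℕ (index (x ⁻¹))

  key-cong : ∀ {x y} → x ≈ y → key x ≡ key y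
  key-cong x≈y = cong₂ (λ i j → toℕ i ⊓ toℕ j) (index-cong x≈y) (index-cong (⁻¹-cong x≈y))

  key-⁻¹ : ∀ x → key (x ⁻¹) ≡ key x
  key-⁻¹ x = trans (cong (λ i → toℕ (index (x ⁻¹)) ⊓ toℕ i) (index-cong (⁻¹-involutive x)))
                   (⊓-comm (toℕ (index (x ⁻¹))) (toℕ (index x)))

  private
    key≡key⇒≈ : ∀ {x y a b} → key x ≡ key y → key x ≡ toℕ (index a) → key y ≡ toℕ (index b) → a ≈ b
    key≡key⇒≈ kx≡ky kx≡a ky≡b = index-injective (toℕ-injective (trans (sym kx≡a) (trans kx≡ky ky≡b)))

  key-injective : ∀ {x y} → key x ≡ key y → x ≈ y ⊎ x ≈ y ⁻¹
  key-injective {x} {y} kx≡ky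
    with ⊓-sel (toℕ (index x)) (toℕ (index (x ⁻¹))) | ⊓-sel (toℕ (index y)) (toℕ (index (y ⁻¹)))
  ... | inj₁ kx≡x   | inj₁ ky≡y   = inj₁ (key≡key⇒≈ kx≡ky kx≡x ky≡y)
  ... | inj₁ kx≡x   | inj₂ ky≡y⁻¹ = inj₂ (key≡key⇒≈ kx≡ky kx≡x ky≡y⁻¹)
  ... | inj₂ kx≡x⁻¹ | inj₁ ky≡y   =
    inj₂ (≈-trans (≈-sym (⁻¹-involutive x)) (⁻¹-cong (key≡key⇒≈ kx≡ky kx≡x⁻¹ ky≡y)))
  ... | inj₂ kx≡x⁻¹ | inj₂ ky≡y⁻¹ = inj₁ (⁻¹-injective (key≡key⇒≈ kx≡ky kx≡x⁻¹ ky≡y⁻¹))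

  -- For x ≉ ε the orbit of x under ⟨J⟩ is {x, J x, x ⁻¹, (J x) ⁻¹}; comparing the keys of
  -- {x, x ⁻¹} and {J x, (J x) ⁻¹} puts exactly one of these two pairs into the connection set.
  connection : Carrier → Bool
  connection x = key x <ᵇ key (J x)

  connection-cong : ∀ {x y} → x ≈ y → connection x ≡ connection y
  connection-cong x≈y = cong₂ _<ᵇ_ (key-cong x≈y) (key-cong (J-cong x≈y))

  connection-⁻¹ : ∀ x → connection (x ⁻¹) ≡ connection x
  connection-⁻¹ x = cong₂ _<ᵇ_ (key-⁻¹ x) (trans (key-cong (J-⁻¹ x)) (key-⁻¹ (J x)))

  connection-ε : connection ε ≡ false
  connection-ε = trans (cong (key ε <ᵇ_) (key-cong J-ε)) (n<ᵇn (key ε))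

  connection-J : ∀ {x} → ¬ x ≈ ε → connection (J x) ≡ not (connection x)
  connection-J {x} x≉ε = begin
    key (J x) <ᵇ key (J (J x)) ≡⟨ cong (key (J x) <ᵇ_) (trans (key-cong (J-J x)) (key-⁻¹ x)) ⟩
    key (J x) <ᵇ key x         ≡⟨ <ᵇ-flip (key x) (key (J x)) (J-moves x≉ε ∘ key-injective ∘ sym) ⟩
    not (key x <ᵇ key (J x))   ∎
    where open ≡-Reasoning

  graph : Graph N
  graph = record
    { adj        = λ i j → connection (element i - element j)
    ; adj-sym    = λ i j → trans (connection-cong (≈-sym (⁻¹-anti-homo‿- (element j) (element i))))
                                 (connection-⁻¹ (element j - element i))
    ; adj-irrefl = λ i → trans (connection-cong (inverseʳ (element i))) connection-ε }

  rotate unrotate : Carrier → Carrier → Carrier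
  rotate   x z = J (z - x) ∙ x
  unrotate x z = J (z - x) ⁻¹ ∙ x

  rotate-cong : ∀ x {z w} → z ≈ w → rotate x z ≈ rotate x w
  rotate-cong x z≈w = ∙-congʳ (J-cong (∙-congʳ z≈w))

  unrotate-cong : ∀ x {z w} → z ≈ w → unrotate x z ≈ unrotate x w
  unrotate-cong x z≈w = ∙-congʳ (⁻¹-cong (J-cong (∙-congʳ z≈w)))

  rotate-fix : ∀ x → rotate x x ≈ x
  rotate-fix x = begin
    J (x - x) ∙ x  ≈⟨ ∙-congʳ (J-cong (inverseʳ x)) ⟩
    J ε ∙ x        ≈⟨ ∙-congʳ J-ε ⟩
    ε ∙ x          ≈⟨ identityˡ x ⟩
    x              ∎
    where open SetoidReasoning setoid

  translate-diff : ∀ a b c → (a ∙ c) - (b ∙ c) ≈ a - b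
  translate-diff a b c = begin
    (a ∙ c) ∙ (b ∙ c) ⁻¹       ≈⟨ ∙-congˡ (⁻¹-∙-comm b c) ⟨
    (a ∙ c) ∙ (b ⁻¹ ∙ c ⁻¹)    ≈⟨ interchange a c (b ⁻¹) (c ⁻¹) ⟩
    (a ∙ b ⁻¹) ∙ (c ∙ c ⁻¹)    ≈⟨ ∙-congˡ (inverseʳ c) ⟩
    (a ∙ b ⁻¹) ∙ ε             ≈⟨ identityʳ (a - b) ⟩
    a - b                      ∎
    where open SetoidReasoning setoid

  rotate-diff : ∀ x z w → rotate x z - rotate x w ≈ J (z - w)
  rotate-diff x z w = begin
    rotate x z - rotate x w          ≈⟨ translate-diff (J (z - x)) (J (w - x)) x ⟩
    J (z - x) ∙ J (w - x) ⁻¹         ≈⟨ ∙-congˡ (J-⁻¹ (w - x)) ⟨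
    J (z - x) ∙ J ((w - x) ⁻¹)       ≈⟨ J-homo (z - x) ((w - x) ⁻¹) ⟨
    J ((z - x) - (w - x))            ≈⟨ J-cong (translate-diff z w (x ⁻¹)) ⟩
    J (z - w)                        ∎
    where open SetoidReasoning setoid

  rotate-unrotate : ∀ x z → rotate x (unrotate x z) ≈ z
  rotate-unrotate x z = begin
    J (unrotate x z - x) ∙ x     ≈⟨ ∙-congʳ (J-cong (//-rightDividesʳ x (J (z - x) ⁻¹))) ⟩
    J (J (z - x) ⁻¹) ∙ x         ≈⟨ ∙-congʳ (J-⁻¹ (J (z - x))) ⟩
    J (J (z - x)) ⁻¹ ∙ x         ≈⟨ ∙-congʳ (J-J-⁻¹ (z - x)) ⟩
    (z - x) ∙ x                  ≈⟨ //-rightDividesˡ x z ⟩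
    z                            ∎
    where open SetoidReasoning setoid

  unrotate-rotate : ∀ x z → unrotate x (rotate x z) ≈ z
  unrotate-rotate x z = begin
    J (rotate x z - x) ⁻¹ ∙ x    ≈⟨ ∙-congʳ (⁻¹-cong (J-cong (//-rightDividesʳ x (J (z - x))))) ⟩
    J (J (z - x)) ⁻¹ ∙ x         ≈⟨ ∙-congʳ (J-J-⁻¹ (z - x)) ⟩
    (z - x) ∙ x                  ≈⟨ //-rightDividesˡ x z ⟩
    z                            ∎
    where open SetoidReasoning setoid

  liftPermutation : (f g : Carrier → Carrier) →
    (∀ {x y} → x ≈ y → f x ≈ f y) → (∀ {x y} → x ≈ y → g x ≈ g y) →
    (∀ z → f (g z) ≈ z) → (∀ z → g (f z) ≈ z) → Permutation′ N
  liftPermutation f g f-cong g-cong f∘g≈id g∘f≈id =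
    mk↔ₛ′ (index ∘ f ∘ element) (index ∘ g ∘ element)
          (lifted-inverse f g f-cong f∘g≈id) (lifted-inverse g f g-cong g∘f≈id)
    where
    lifted-inverse : ∀ h k → (∀ {x y} → x ≈ y → h x ≈ h y) → (∀ z → h (k z) ≈ z) →
      ∀ i → index (h (element (index (k (element i))))) ≡ i
    lifted-inverse h k h-cong h∘k≈id i =
      trans (index-cong (≈-trans (h-cong (element-index _)) (h∘k≈id (element i)))) (index-element i)

  rotation : Fin N → Permutation′ N
  rotation i = liftPermutation (rotate x) (unrotate x) (rotate-cong x) (unrotate-cong x)
                               (rotate-unrotate x) (unrotate-rotate x)
    where x = element i

  rotation-isAntimorphism : ∀ i → IsAntimorphism graph (rotation i)
  rotation-isAntimorphism i = record { flips = λ a b a≢b → begin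
    connection (element (rotation i ⟨$⟩ʳ a) - element (rotation i ⟨$⟩ʳ b))
      ≡⟨ connection-cong (∙-cong (element-index _) (⁻¹-cong (element-index _))) ⟩
    connection (rotate x (element a) - rotate x (element b))
      ≡⟨ connection-cong (rotate-diff x (element a) (element b)) ⟩
    connection (J (element a - element b))
      ≡⟨ connection-J (λ diff≈ε → a≢b (trans (sym (index-element a))
           (trans (index-cong (x∙y⁻¹≈ε⇒x≈y (element a) (element b) diff≈ε)) (index-element b)))) ⟩
    not (connection (element a - element b)) ∎ }
    where
    x = element i
    open ≡-Reasoning

  fixingAntimorphisms : FixingAntimorphisms N
  fixingAntimorphisms = record
    { graph            = graph
    ; antimorphism     = rotation
    ; antimorphism-fix = λ i → trans (index-cong (rotate-fix (element i))) (index-element i)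
    ; isAntimorphism   = rotation-isAntimorphism }

-- The integers modulo n, represented by natural numbers

module Modular (n′ : ℕ) where

  private
    n = suc n′

  infix 4 _≈_
  record _≈_ (x y : ℕ) : Set where
    constructor ≡-mod
    field %-≡ : x % n ≡ y % n
  open _≈_

  ≈-refl : ∀ {x} → x ≈ x
  ≈-refl = ≡-mod refl

  ≈-isEquivalence : IsEquivalence _≈_
  ≈-isEquivalence = record
    { refl  = ≈-refl
    ; sym   = λ (≡-mod x≡y) → ≡-mod (sym x≡y)
    ; trans = λ (≡-mod x≡y) (≡-mod y≡z) → ≡-mod (trans x≡y y≡z) }

  _≈?_ : ∀ x y → Dec (x ≈ y)
  x ≈? y = map′ ≡-mod %-≡ (x % n ≟ y % n)

  ≡⇒≈ : ∀ {x y} → x ≡ y → x ≈ y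
  ≡⇒≈ x≡y = ≡-mod (cong (_% n) x≡y)

  +-cong : ∀ {x x′ y y′} → x ≈ x′ → y ≈ y′ → x + y ≈ x′ + y′
  +-cong {x} {x′} {y} {y′} (≡-mod x≡x′) (≡-mod y≡y′) = ≡-mod
    (trans (%-distribˡ-+ x y n) (trans (cong₂ (λ a b → (a + b) % n) x≡x′ y≡y′) (sym (%-distribˡ-+ x′ y′ n))))

  *-congˡ : ∀ c {x y} → x ≈ y → c * x ≈ c * y
  *-congˡ c {x} {y} (≡-mod x≡y) = ≡-mod
    (trans (%-distribˡ-* c x n) (trans (cong (λ a → (c % n * a) % n) x≡y) (sym (%-distribˡ-* c y n))))

  neg : ℕ → ℕ
  neg x = n′ * x

  *-neg : ∀ a y → a * neg y ≡ neg (a * y)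
  *-neg a y = trans (sym (*-assoc a n′ y)) (trans (cong (_* y) (*-comm a n′)) (*-assoc n′ a y))

  +-neg : ∀ x → x + neg x ≈ 0
  +-neg x = ≡-mod (trans (cong (_% n) (*-comm n x)) (m*n%n≡0 x n))

  ℤ/ : AbelianGroup 0ℓ 0ℓ
  ℤ/ = record
    { Carrier = ℕ ; _≈_ = _≈_ ; _∙_ = _+_ ; ε = 0 ; _⁻¹ = neg
    ; isAbelianGroup = record
      { isGroup = record
        { isMonoid = record
          { isSemigroup = record
            { isMagma = record { isEquivalence = ≈-isEquivalence ; ∙-cong = +-cong }
            ; assoc = λ x y z → ≡⇒≈ (+-assoc x y z) }
          ; identity = (λ x → ≈-refl) , (λ x → ≡⇒≈ (+-identityʳ x)) }
        ; inverse = (λ x → ≡-mod (trans (cong (_% n) (+-comm (neg x) x)) (%-≡ (+-neg x)))) , +-neg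
        ; ⁻¹-cong = *-congˡ n′ }
      ; comm = λ x y → ≡⇒≈ (+-comm x y) } }

  index : ℕ → Fin n
  index x = fromℕ< (m%n<n x n)

  index-cong : ∀ {x y} → x ≈ y → index x ≡ index y
  index-cong (≡-mod x≡y) = toℕ-injective (trans (toℕ-fromℕ< _) (trans x≡y (sym (toℕ-fromℕ< _))))

  index-injective : ∀ {x y} → index x ≡ index y → x ≈ y
  index-injective ix≡iy = ≡-mod (trans (sym (toℕ-fromℕ< _)) (trans (cong toℕ ix≡iy) (toℕ-fromℕ< _)))

  index-toℕ : ∀ i → index (toℕ i) ≡ i
  index-toℕ i = toℕ-injective (trans (toℕ-fromℕ< _) (m<n⇒m%n≡m (toℕ<n i)))

  odd⇒coprime-2 : n % 2 ≡ 1 → Coprime n 2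
  odd⇒coprime-2 odd {0}                 (_   , 0∣2) = contradiction (0∣⇒≡0 0∣2) λ ()
  odd⇒coprime-2 odd {1}                 _           = refl
  odd⇒coprime-2 odd {2}                 (2∣n , _)   = contradiction (trans (sym (n∣m⇒m%n≡0 n 2 2∣n)) odd) λ ()
  odd⇒coprime-2 odd {suc (suc (suc i))} (_   , i∣2) = contradiction (∣⇒≤ i∣2) λ { (s≤s (s≤s ())) }

  odd⇒no-2-torsion : n % 2 ≡ 1 → ∀ {x} → x ≈ neg x → x ≈ 0
  odd⇒no-2-torsion odd {x} x≈-x = ≡-mod (n∣m⇒m%n≡0 x n (coprime-divisor (odd⇒coprime-2 odd)
    (subst (n ∣_) (cong (x +_) (sym (+-identityʳ x)))
      (m%n≡0⇒n∣m (x + x) n (%-≡ (+-cong (≈-refl {x}) x≈-x) ⟨ trans ⟩ %-≡ (+-neg x))))))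

  cyclicGaussian : ∀ j → n ∣ suc (j * j) → n % 2 ≡ 1 → GaussianModule n
  cyclicGaussian j n∣j²+1 odd = record
    { additiveGroup   = ℤ/
    ; J               = j *_
    ; J-cong          = *-congˡ j
    ; J-homo          = λ x y → ≡⇒≈ (*-distribˡ-+ j x y)
    ; J-J             = λ x → inverseʳ-unique x (j * (j * x)) (j²+1-annihilates x)
    ; no-2-torsion    = odd⇒no-2-torsion odd
    ; index           = index
    ; element         = toℕ
    ; index-cong      = index-cong
    ; index-injective = index-injective
    ; index-element   = index-toℕ }
    where
    open AbelianGroupProperties ℤ/ using (inverseʳ-unique)
    j²+1-annihilates : ∀ x → x + j * (j * x) ≈ 0
    j²+1-annihilates x =
      ≡-mod (n∣m⇒m%n≡0 _ n (subst (n ∣_) (cong (x +_) (*-assoc j j x)) (∣m⇒∣m*n x n∣j²+1)))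

  squareGaussian : n % 2 ≡ 1 → GaussianModule (n * n)
  squareGaussian odd = record
    { additiveGroup   = ℤ/ ×-abelianGroup ℤ/
    ; J               = λ (a , b) → neg b , a
    ; J-cong          = λ (a≈a′ , b≈b′) → *-congˡ n′ b≈b′ , a≈a′
    ; J-homo          = λ (a , b) (a′ , b′) → ≡⇒≈ (*-distribˡ-+ n′ b b′) , ≈-refl
    ; J-J             = λ _ → ≈-refl , ≈-refl
    ; no-2-torsion    = λ (a≈-a , b≈-b) → odd⇒no-2-torsion odd a≈-a , odd⇒no-2-torsion odd b≈-b
    ; index           = λ (a , b) → combine (index a) (index b)
    ; element         = λ i → ×-map toℕ toℕ (remQuot {n} n i)
    ; index-cong      = λ (a≈a′ , b≈b′) → cong₂ combine (index-cong a≈a′) (index-cong b≈b′)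
    ; index-injective = λ {(a , b)} {(a′ , b′)} eq →
        let ia≡ia′ , ib≡ib′ = combine-injective (index a) (index b) (index a′) (index b′) eq
        in index-injective ia≡ia′ , index-injective ib≡ib′
    ; index-element   = λ i → let x , y = remQuot {n} n i in
                          trans (cong₂ combine (index-toℕ x) (index-toℕ y)) (combine-remQuot {n} n i) }

-- Involutions of a finite set

indicator : Bool → ℕ
indicator b = if b then 1 else 0

count : ∀ {n} → (Fin n → Bool) → ℕ
count P = sum (indicator ∘ P)

sum-ones : ∀ n → sum {n} (λ _ → 1) ≡ n
sum-ones zero    = refl
sum-ones (suc n) = cong suc (sum-ones n)

module _ {n} (f : Fin n → Fin n) (f-involutive : ∀ x → f (f x) ≡ x) where

  fixed ascending : Fin n → Bool
  fixed     x = does (f x ≟ᶠ x)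
  ascending x = toℕ x <ᵇ toℕ (f x)

  involution-parity : n ≡ count fixed + 2 * count ascending
  involution-parity = begin
    n                                                ≡⟨ sum-ones n ⟨
    sum {n} (λ _ → 1)                                ≡⟨ sum-cong-≗ trichotomy ⟨
    sum (λ x → #fixed x + (#asc x + #asc (f x)))     ≡⟨ ∑-distrib-+ #fixed _ ⟩
    count fixed + sum (λ x → #asc x + #asc (f x))    ≡⟨ cong (count fixed +_) (∑-distrib-+ #asc (#asc ∘ f)) ⟩
    count fixed + (count ascending + sum (#asc ∘ f))
      ≡⟨ cong (λ s → count fixed + (count ascending + s)) #asc≡#asc∘f ⟨
    count fixed + (count ascending + count ascending)
      ≡⟨ cong (λ s → count fixed + (count ascending + s)) (+-identityʳ _) ⟨
    count fixed + 2 * count ascending                ∎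
    where
    open ≡-Reasoning
    #fixed #asc : Fin n → ℕ
    #fixed = indicator ∘ fixed
    #asc   = indicator ∘ ascending
    #asc≡#asc∘f : sum #asc ≡ sum (#asc ∘ f)
    #asc≡#asc∘f = sum-permute #asc (permutation f f f-involutive f-involutive)
    trichotomy : ∀ x → #fixed x + (#asc x + #asc (f x)) ≡ 1
    trichotomy x rewrite f-involutive x with f x ≟ᶠ x
    ... | yes fx≡x rewrite fx≡x | n<ᵇn (toℕ x) = refl
    ... | no  fx≢x rewrite <ᵇ-flip (toℕ x) (toℕ (f x)) (fx≢x ∘ sym ∘ toℕ-injective) with toℕ x <ᵇ toℕ (f x)
    ...   | true  = refl
    ...   | false = refl

involution-unique-fixed-point : ∀ {n} (f : Fin n → Fin n) (f-involutive : ∀ x → f (f x) ≡ x) (x₀ : Fin n) →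
  f x₀ ≡ x₀ → (∀ x → f x ≡ x → x ≡ x₀) → ∃ λ k → n ≡ suc (2 * k)
involution-unique-fixed-point {suc n} f f-involutive x₀ fx₀≡x₀ fixed⇒x₀ =
  count (ascending f f-involutive) ,
  trans (involution-parity f f-involutive) (cong (_+ 2 * count (ascending f f-involutive)) one-fixed)
  where
  one-fixed : count (fixed f f-involutive) ≡ 1
  one-fixed = begin
    count (fixed f f-involutive)                          ≡⟨ sum-remove {i = x₀} #fixed ⟩
    #fixed x₀ + sum (λ y → #fixed (punchIn x₀ y))
      ≡⟨ cong₂ _+_ (cong indicator (dec-true (f x₀ ≟ᶠ x₀) fx₀≡x₀))
                   (sum-cong-≗ λ y → cong indicator (dec-false (f (punchIn x₀ y) ≟ᶠ punchIn x₀ y)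
                                                               (punchInᵢ≢i x₀ y ∘ fixed⇒x₀ (punchIn x₀ y)))) ⟩
    1 + sum {n} (λ _ → 0)                                 ≡⟨ cong suc (sum-replicate-zero n) ⟩
    1                                                     ∎
    where
    open ≡-Reasoning
    #fixed : Fin (suc n) → ℕ
    #fixed = indicator ∘ fixed f f-involutive

-- A square root of −1 modulo a prime p ≡ 1 (mod 4)

module HalfSystem (h : ℕ) (p-prime : Prime (suc (h + h))) where
  open Modular (h + h)
  open AbelianGroup ℤ/ using (setoid) renaming (sym to ≈-sym; trans to ≈-trans)
  open AbelianGroupProperties ℤ/ using (x∙y⁻¹≈ε⇒x≈y; x≈y⇒x∙y⁻¹≈ε; ∙-cancelʳ)

  p : ℕ
  p = suc (h + h)

  ≈0⇒∣ : ∀ {x} → x ≈ 0 → p ∣ x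
  ≈0⇒∣ {x} (≡-mod x%p≡0) = m%n≡0⇒n∣m x p x%p≡0

  ∣⇒≈0 : ∀ {x} → p ∣ x → x ≈ 0
  ∣⇒≈0 {x} p∣x = ≡-mod (n∣m⇒m%n≡0 x p p∣x)

  small-≉0 : ∀ {x} → 0 < x → x < p → ¬ x ≈ 0
  small-≉0 {suc x} _ x<p x≈0 = >⇒∤ x<p (≈0⇒∣ x≈0)

  *-≈0 : ∀ x y → x * y ≈ 0 → x ≈ 0 ⊎ y ≈ 0
  *-≈0 x y xy≈0 with euclidsLemma x y p-prime (≈0⇒∣ xy≈0)
  ... | inj₁ p∣x = inj₁ (∣⇒≈0 p∣x)
  ... | inj₂ p∣y = inj₂ (∣⇒≈0 p∣y)

  *-cancelˡ : ∀ {a x y} → ¬ a ≈ 0 → a * x ≈ a * y → x ≈ y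
  *-cancelˡ {a} {x} {y} a≉0 ax≈ay
    with *-≈0 a (x + neg y) (≈-trans (≡⇒≈ (trans (*-distribˡ-+ a x (neg y)) (cong (a * x +_) (*-neg a y))))
                                     (x≈y⇒x∙y⁻¹≈ε ax≈ay))
  ... | inj₁ a≈0   = ⊥-elim (a≉0 a≈0)
  ... | inj₂ x-y≈0 = x∙y⁻¹≈ε⇒x≈y x y x-y≈0

  small-≈⇒≡ : ∀ {x y} → x < p → y < p → x ≈ y → x ≡ y
  small-≈⇒≡ x<p y<p (≡-mod x%p≡y%p) = trans (sym (m<n⇒m%n≡m x<p)) (trans x%p≡y%p (m<n⇒m%n≡m y<p))

  -- Pairing x ∈ {1, …, h} with the y ∈ {1, …, h} such that x y ≡ ±1 is an involution whose fixed
  -- points are 1 and the square roots of −1; when h is even there must be such a square root.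
  Reciprocal : ℕ → ℕ → Set
  Reciprocal a b = a * b ≈ 1 ⊎ a * b + 1 ≈ 0

  reciprocal-sym : ∀ a b → Reciprocal a b → Reciprocal b a
  reciprocal-sym a b (inj₁ ab≈1)   = inj₁ (≈-trans (≡⇒≈ (*-comm b a)) ab≈1)
  reciprocal-sym a b (inj₂ ab+1≈0) = inj₂ (≈-trans (≡⇒≈ (cong (_+ 1) (*-comm b a))) ab+1≈0)

  reciprocal-cong : ∀ a {b c} → b ≈ c → Reciprocal a b → Reciprocal a c
  reciprocal-cong a b≈c (inj₁ ab≈1)   = inj₁ (≈-trans (*-congˡ a (≈-sym b≈c)) ab≈1)
  reciprocal-cong a b≈c (inj₂ ab+1≈0) = inj₂ (≈-trans (+-cong (*-congˡ a (≈-sym b≈c)) ≈-refl) ab+1≈0)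

  reciprocal-negate : ∀ a b c → a * b + a * c ≈ 0 → Reciprocal a c → Reciprocal a b
  reciprocal-negate a b c ab+ac≈0 (inj₁ ac≈1) = inj₂ (begin
    a * b + 1         ≈⟨ +-cong (≈-refl {a * b}) ac≈1 ⟨
    a * b + a * c     ≈⟨ ab+ac≈0 ⟩
    0                 ∎)
    where open SetoidReasoning setoid
  reciprocal-negate a b c ab+ac≈0 (inj₂ ac+1≈0) = inj₁ (begin
    a * b                   ≡⟨ +-identityʳ (a * b) ⟨
    a * b + 0               ≈⟨ +-cong (≈-refl {a * b}) ac+1≈0 ⟨
    a * b + (a * c + 1)     ≡⟨ +-assoc (a * b) (a * c) 1 ⟨
    a * b + a * c + 1       ≈⟨ +-cong ab+ac≈0 (≈-refl {1}) ⟩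
    1                       ∎)
    where open SetoidReasoning setoid

  reciprocal-exists : ∀ a → 0 < a → a < p → ∃ (Reciprocal a)
  reciprocal-exists a@(suc _) _ a<p with coprime-Bézout (prime⇒coprime p-prime a<p)
  ... | Bézout.+- x y 1+ya≡xp = y , inj₂ (≡-mod (trans (cong (_% p) ay+1≡xp) (m*n%n≡0 x p)))
    where
    ay+1≡xp : a * y + 1 ≡ x * p
    ay+1≡xp = trans (+-comm (a * y) 1) (trans (cong suc (*-comm a y)) 1+ya≡xp)
  ... | Bézout.-+ x y 1+xp≡ya =
    y , inj₁ (≡-mod (trans (cong (_% p) (trans (*-comm a y) (sym 1+xp≡ya))) ([m+kn]%n≡m%n 1 x p)))

  1≉0 : ¬ 1 ≈ 0
  1≉0 1≈0 = ¬prime[1] (subst Prime (∣1⇒≡1 (≈0⇒∣ 1≈0)) p-prime)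

  *-absorbs-≈0 : ∀ a {b} → b ≈ 0 → a * b ≈ 0
  *-absorbs-≈0 a b≈0 = ≈-trans (*-congˡ a b≈0) (≡⇒≈ (*-zeroʳ a))

  reciprocal-≉0 : ∀ {a b} → Reciprocal a b → ¬ b ≈ 0
  reciprocal-≉0 {a} (inj₁ ab≈1)   b≈0 = 1≉0 (≈-trans (≈-sym ab≈1) (*-absorbs-≈0 a b≈0))
  reciprocal-≉0 {a} (inj₂ ab+1≈0) b≈0 = 1≉0 (≈-trans (+-cong (≈-sym (*-absorbs-≈0 a b≈0)) (≈-refl {1})) ab+1≈0)

  val : Fin h → ℕ
  val w = suc (toℕ w)

  val<p : ∀ w → val w < p
  val<p w = s≤s (≤-trans (toℕ<n w) (m≤m+n h h))

  representative : ∀ r → 0 < r → r < p → Σ (Fin h) λ w → val w ≡ r ⊎ val w + r ≡ p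
  representative (suc r₀) _ (s≤s r≤2h) with suc r₀ ≤? h
  ... | yes r≤h = fromℕ< r≤h , inj₁ (cong suc (toℕ-fromℕ< r≤h))
  ... | no  r≰h = fromℕ< w<h , inj₂ (cong suc (trans (cong (_+ suc r₀) (toℕ-fromℕ< w<h)) (m∸n+n≡m r≤2h)))
    where
    w<h : h + h ∸ suc r₀ < h
    w<h = <-≤-trans (∸-monoʳ-< (≰⇒> r≰h) r≤2h) (≤-reflexive (m+n∸m≡n h h))

  ≉0⇒0<%p : ∀ {u} → ¬ u ≈ 0 → 0 < u % p
  ≉0⇒0<%p {u} u≉0 with u % p in u%p≡r
  ... | zero  = ⊥-elim (u≉0 (≡-mod u%p≡r))
  ... | suc _ = s≤s z≤n

  ≈%p : ∀ u → u ≈ u % p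
  ≈%p u = ≡-mod (sym (m%n%n≡m%n u p))

  partner : ∀ x → Σ (Fin h) λ y → Reciprocal (val x) (val y)
  partner x with reciprocal-exists (val x) (s≤s z≤n) (val<p x)
  ... | u , recip with representative (u % p) (≉0⇒0<%p (reciprocal-≉0 {val x} {u} recip)) (m%n<n u p)
  ...   | w , inj₁ vw≡r   = w , reciprocal-cong (val x) (≈-trans (≈%p u) (≡⇒≈ (sym vw≡r))) recip
  ...   | w , inj₂ vw+r≡p = w , reciprocal-negate (val x) (val w) u (begin
    val x * val w + val x * u           ≈⟨ +-cong (≈-refl {val x * val w}) (*-congˡ (val x) (≈%p u)) ⟩
    val x * val w + val x * (u % p)     ≡⟨ *-distribˡ-+ (val x) (val w) (u % p) ⟨
    val x * (val w + u % p)             ≡⟨ cong (val x *_) vw+r≡p ⟩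
    val x * p                           ≈⟨ ≡-mod (m*n%n≡0 (val x) p) ⟩
    0                                   ∎) recip
    where open SetoidReasoning setoid

  val-≈⇒≡ : ∀ {x y} → val x ≈ val y → x ≡ y
  val-≈⇒≡ {x} {y} vx≈vy = toℕ-injective (suc-injective (small-≈⇒≡ (val<p x) (val<p y) vx≈vy))

  same-product⇒≡ : ∀ w {x y} → val w * val x ≈ val w * val y → x ≡ y
  same-product⇒≡ w wx≈wy = val-≈⇒≡ (*-cancelˡ (small-≉0 (s≤s z≤n) (val<p w)) wx≈wy)

  opposite-products-impossible : ∀ w x y → ¬ val w * val x + val w * val y ≈ 0
  opposite-products-impossible w x y wx+wy≈0
    with *-≈0 (val w) (val x + val y) (≈-trans (≡⇒≈ (*-distribˡ-+ (val w) (val x) (val y))) wx+wy≈0)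
  ... | inj₁ w≈0   = small-≉0 (s≤s z≤n) (val<p w) w≈0
  ... | inj₂ x+y≈0 = small-≉0 (s≤s z≤n) (s≤s (+-mono-≤ (toℕ<n x) (toℕ<n y))) x+y≈0

  reciprocal-unique : ∀ w {x y} → Reciprocal (val w) (val x) → Reciprocal (val w) (val y) → x ≡ y
  reciprocal-unique w (inj₁ wx≈1)   (inj₁ wy≈1)   = same-product⇒≡ w (≈-trans wx≈1 (≈-sym wy≈1))
  reciprocal-unique w (inj₂ wx+1≈0) (inj₂ wy+1≈0) =
    same-product⇒≡ w (∙-cancelʳ 1 _ _ (≈-trans wx+1≈0 (≈-sym wy+1≈0)))
  reciprocal-unique w {x} {y} (inj₁ wx≈1) (inj₂ wy+1≈0) = ⊥-elim (opposite-products-impossible w x y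
    (≈-trans (+-cong wx≈1 (≈-refl {val w * val y})) (≈-trans (≡⇒≈ (+-comm 1 (val w * val y))) wy+1≈0)))
  reciprocal-unique w {x} {y} (inj₂ wx+1≈0) (inj₁ wy≈1) = ⊥-elim (opposite-products-impossible w x y
    (≈-trans (+-cong (≈-refl {val w * val x}) wy≈1) wx+1≈0))

  pair : Fin h → Fin h
  pair x = proj₁ (partner x)

  pair-reciprocal : ∀ x → Reciprocal (val x) (val (pair x))
  pair-reciprocal x = proj₂ (partner x)

  pair-involutive : ∀ x → pair (pair x) ≡ x
  pair-involutive x = reciprocal-unique (pair x) (pair-reciprocal (pair x))
                                        (reciprocal-sym (val x) (val (pair x)) (pair-reciprocal x))

  [1+c]²≡c[2+c]+1 : ∀ c → suc c * suc c ≡ c * (2 + c) + 1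
  [1+c]²≡c[2+c]+1 = solve-∀

  square≈1⇒val≡1 : ∀ x → val x * val x ≈ 1 → toℕ x ≡ 0
  square≈1⇒val≡1 x x²≈1
    with *-≈0 (toℕ x) (2 + toℕ x) (∙-cancelʳ 1 _ _ (≈-trans (≡⇒≈ (sym ([1+c]²≡c[2+c]+1 (toℕ x)))) x²≈1))
  ... | inj₁ c≈0   = small-≈⇒≡ (<-≤-trans (n<1+n (toℕ x)) (<⇒≤ (val<p x))) (s≤s z≤n) c≈0
  ... | inj₂ 2+c≈0 = ⊥-elim (small-≉0 (s≤s z≤n) 2+c<p 2+c≈0)
    where
    2+c<p : 2 + toℕ x < p
    2+c<p = s≤s (≤-trans (≤-reflexive (+-comm 1 (val x))) (+-mono-≤ (toℕ<n x) (≤-trans (s≤s z≤n) (toℕ<n x))))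

  pair-fixed : ∀ x → pair x ≡ x → toℕ x ≡ 0 ⊎ val x * val x + 1 ≈ 0
  pair-fixed x px≡x with subst (λ y → Reciprocal (val x) (val y)) px≡x (pair-reciprocal x)
  ... | inj₁ x²≈1   = inj₁ (square≈1⇒val≡1 x x²≈1)
  ... | inj₂ x²+1≈0 = inj₂ x²+1≈0

  module _ (one : Fin h) (one≡0 : toℕ one ≡ 0) where

    pair-one : pair one ≡ one
    pair-one = reciprocal-unique one (pair-reciprocal one) (inj₁ (≡⇒≈ (cong (λ v → suc v * suc v) one≡0)))

    only-fixed-one : ¬ ∃ (λ x → val x * val x + 1 ≈ 0) → ∀ x → pair x ≡ x → x ≡ one
    only-fixed-one ∄x²+1≈0 x px≡x with pair-fixed x px≡x
    ... | inj₁ x≡0    = toℕ-injective (trans x≡0 (sym one≡0))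
    ... | inj₂ x²+1≈0 = ⊥-elim (∄x²+1≈0 (x , x²+1≈0))

    minus-one-square-root : ∀ t → h ≡ 2 * t → ∃ λ j → p ∣ suc (j * j)
    minus-one-square-root t h≡2t with any? (λ x → (val x * val x + 1) ≈? 0)
    ... | yes (x , x²+1≈0) = val x , subst (p ∣_) (+-comm (val x * val x) 1) (≈0⇒∣ x²+1≈0)
    ... | no  ∄x²+1≈0 =
      let k , h≡odd = involution-unique-fixed-point pair pair-involutive one pair-one (only-fixed-one ∄x²+1≈0)
      in ⊥-elim (even≢odd t k (trans (sym h≡2t) h≡odd))

minus-one-is-square : ∀ {p} → Prime p → p % 4 ≡ 1 → ∃ λ j → p ∣ suc (j * j)
minus-one-is-square {p} p-prime p%4≡1 =
  from-quotient (p / 4) (trans (m≡m%n+[m/n]*n p 4) (cong (_+ (p / 4) * 4) p%4≡1))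
  where
  from-quotient : ∀ l → p ≡ 1 + l * 4 → ∃ λ j → p ∣ suc (j * j)
  from-quotient zero    p≡1    = ⊥-elim (¬prime[1] (subst Prime p≡1 p-prime))
  from-quotient (suc t) p≡4l+1 =
    subst (λ q → ∃ λ j → q ∣ suc (j * j)) (sym p≡2h+1) (minus-one-square-root zero refl (suc t) refl)
    where
    rearrange : ∀ t → 1 + suc t * 4 ≡ suc (2 * suc t + 2 * suc t)
    rearrange = solve-∀
    p≡2h+1 : p ≡ suc (2 * suc t + 2 * suc t)
    p≡2h+1 = trans p≡4l+1 (rearrange t)
    open HalfSystem (2 * suc t) (subst Prime p≡2h+1 p-prime)

%4≡1⇒%2≡1 : ∀ q → q % 4 ≡ 1 → q % 2 ≡ 1
%4≡1⇒%2≡1 q q%4≡1 = trans (sym (m∣n⇒o%n%m≡o%m 2 4 q (divides 2 refl))) (cong (_% 2) q%4≡1)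

odd-square-%4 : ∀ x → x % 2 ≡ 1 → (x * x) % 4 ≡ 1
odd-square-%4 x x%2≡1 = begin
  (x * x) % 4                       ≡⟨ cong (λ z → (z * z) % 4) x≡1+2y ⟩
  ((1 + y * 2) * (1 + y * 2)) % 4   ≡⟨ cong (_% 4) (expand y) ⟩
  (1 + (y * y + y) * 4) % 4         ≡⟨ [m+kn]%n≡m%n 1 (y * y + y) 4 ⟩
  1                                 ∎
  where
  open ≡-Reasoning
  y = x / 2
  x≡1+2y : x ≡ 1 + y * 2
  x≡1+2y = trans (m≡m%n+[m/n]*n x 2) (cong (_+ y * 2) x%2≡1)
  expand : ∀ y → (1 + y * 2) * (1 + y * 2) ≡ 1 + (y * y + y) * 4
  expand = solve-∀

odd-factorʳ : ∀ a b → (a * b) % 2 ≡ 1 → b % 2 ≡ 1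
odd-factorʳ a b ab%2≡1 with b % 2 in b%2≡r | m%n<n b 2
... | 0           | _ = contradiction (trans (sym ab%2≡0) ab%2≡1) λ ()
  where
  ab%2≡0 : (a * b) % 2 ≡ 0
  ab%2≡0 = trans (%-distribˡ-* a b 2)
             (trans (cong (λ r → (a % 2 * r) % 2) b%2≡r) (cong (_% 2) (*-zeroʳ (a % 2))))
... | 1           | _ = refl
... | suc (suc _) | s≤s (s≤s ())

even-or-odd : ∀ e → ∃ λ f → e ≡ f + f ⊎ e ≡ suc (f + f)
even-or-odd zero    = 0 , inj₁ refl
even-or-odd (suc e) with even-or-odd e
... | f , inj₁ e≡2f   = f , inj₂ (cong suc e≡2f)
... | f , inj₂ e≡2f+1 = suc f , inj₁ (cong suc (trans e≡2f+1 (sym (+-suc f f))))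

primeFixing : ∀ {p} → Prime p → p % 4 ≡ 1 → FixingAntimorphisms p
primeFixing {zero}   p-prime _      = ⊥-elim (¬prime[0] p-prime)
primeFixing {suc p′} p-prime p%4≡1 =
  let j , p∣j²+1 = minus-one-is-square p-prime p%4≡1
  in GaussianPaley.fixingAntimorphisms (Modular.cyclicGaussian p′ j p∣j²+1 (%4≡1⇒%2≡1 (suc p′) p%4≡1))

squareFixing : ∀ x → x % 2 ≡ 1 → FixingAntimorphisms (x * x)
squareFixing (suc x′) x%2≡1 = GaussianPaley.fixingAntimorphisms (Modular.squareGaussian x′ x%2≡1)

-- With an even exponent q is the square of an odd number; with an odd exponent q ≡ p (mod 4),
-- because odd squares are ≡ 1 (mod 4).
primePowerFixing : ∀ q → IsPrimePower q → q % 4 ≡ 1 → FixingAntimorphisms q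
primePowerFixing q (p , e , p-prime , _ , q≡p^e) q%4≡1 with even-or-odd e
... | f , inj₁ e≡2f = subst FixingAntimorphisms (sym q≡x*x)
  (squareFixing x (odd-factorʳ x x (subst (λ z → z % 2 ≡ 1) q≡x*x (%4≡1⇒%2≡1 q q%4≡1))))
  where
  x = p ^ f
  q≡x*x : q ≡ x * x
  q≡x*x = trans q≡p^e (trans (cong (p ^_) e≡2f) (^-distribˡ-+-* p f f))
... | f , inj₂ e≡2f+1 = subst FixingAntimorphisms (sym q≡p^e) (powerFixing (primeFixing p-prime p%4≡1) e)
  where
  x = p ^ f
  q≡p*x*x : q ≡ p * (x * x)
  q≡p*x*x = trans q≡p^e (trans (cong (p ^_) e≡2f+1) (cong (p *_) (^-distribˡ-+-* p f f)))
  x*x%4≡1 : (x * x) % 4 ≡ 1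
  x*x%4≡1 = odd-square-%4 x (odd-factorʳ x x
              (odd-factorʳ p (x * x) (subst (λ z → z % 2 ≡ 1) q≡p*x*x (%4≡1⇒%2≡1 q q%4≡1))))
  p%4≡1 : p % 4 ≡ 1
  p%4≡1 = begin
    p % 4                        ≡⟨ m%n%n≡m%n p 4 ⟨
    (p % 4) % 4                  ≡⟨ cong (_% 4) (*-identityʳ (p % 4)) ⟨
    (p % 4 * 1) % 4              ≡⟨ cong (λ r → (p % 4 * r) % 4) x*x%4≡1 ⟨
    (p % 4 * ((x * x) % 4)) % 4  ≡⟨ %-distribˡ-* p (x * x) 4 ⟨
    (p * (x * x)) % 4            ≡⟨ cong (_% 4) q≡p*x*x ⟨
    q % 4                        ≡⟨ q%4≡1 ⟩
    1                            ∎
    where open ≡-Reasoning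

productFixing : ∀ m → ProdPrimePowers1mod4 m → FixingAntimorphisms m
productFixing m (qs , qs-ok , refl) = fixing qs-ok
  where
  fixing : ∀ {qs} → All (λ q → IsPrimePower q × q % 4 ≡ 1) qs → FixingAntimorphisms (product qs)
  fixing []                         = singleVertex
  fixing ((q-power , q%4≡1) ∷ qs-ok) = lexicographicFixing (primePowerFixing _ q-power q%4≡1) (fixing qs-ok)

product-%4 : ∀ m → ProdPrimePowers1mod4 m → m % 4 ≡ 1
product-%4 m (qs , qs-ok , refl) = product-%4≡1 qs-ok
  where
  product-%4≡1 : ∀ {qs} → All (λ q → IsPrimePower q × q % 4 ≡ 1) qs → product qs % 4 ≡ 1
  product-%4≡1 []                               = refl
  product-%4≡1 {q ∷ qs} ((_ , q%4≡1) ∷ qs-ok) =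
    trans (%-distribˡ-* q (product qs) 4) (cong₂ (λ a b → (a * b) % 4) q%4≡1 (product-%4≡1 qs-ok))

theta-%4≡3 : ∀ v → v % 4 ≡ 3 → theta v ≡ 4 * (v / 4)
theta-%4≡3 v v%4≡3 rewrite v%4≡3 = refl

theta-%4≡0 : ∀ v → v % 4 ≡ 0 → theta v ≡ 4 * (v / 4) ∸ 3
theta-%4≡0 v v%4≡0 rewrite v%4≡0 = refl

theta-%4≡1 : ∀ v → v % 4 ≡ 1 → theta v ≡ 4 * (v / 4) ∸ 3
theta-%4≡1 v v%4≡1 rewrite v%4≡1 = refl

[c+4l]/4≡l : ∀ c l → c < 4 → (c + l * 4) / 4 ≡ l
[c+4l]/4≡l c l c<4 = trans (+-distrib-/-∣ʳ c (divides l refl)) (cong₂ _+_ (m<n⇒m/n≡0 c<4) (m*n/n≡m l 4))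

4[1+l]∸3≡1+4l : ∀ l → 4 * suc l ∸ 3 ≡ suc (4 * l)
4[1+l]∸3≡1+4l l = trans (cong (_∸ 3) (expand l)) (m+n∸m≡n 3 (suc (4 * l)))
  where
  expand : ∀ l → 4 * suc l ≡ 3 + suc (4 * l)
  expand = solve-∀

theta-3+4l : ∀ l → theta (3 + l * 4) ≡ 4 * l
theta-3+4l l = trans (theta-%4≡3 (3 + l * 4) ([m+kn]%n≡m%n 3 l 4)) (cong (4 *_) ([c+4l]/4≡l 3 l ≤-refl))

theta-4+4l : ∀ l → theta (0 + suc l * 4) ≡ suc (4 * l)
theta-4+4l l = trans (theta-%4≡0 (0 + suc l * 4) ([m+kn]%n≡m%n 0 (suc l) 4))
                     (trans (cong (λ q → 4 * q ∸ 3) ([c+4l]/4≡l 0 (suc l) z<s)) (4[1+l]∸3≡1+4l l))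

theta-5+4l : ∀ l → theta (1 + suc l * 4) ≡ suc (4 * l)
theta-5+4l l = trans (theta-%4≡1 (1 + suc l * 4) ([m+kn]%n≡m%n 1 (suc l) 4))
                     (trans (cong (λ q → 4 * q ∸ 3) ([c+4l]/4≡l 1 (suc l) (s<s z<s))) (4[1+l]∸3≡1+4l l))

theta-slack₂ : ∀ l → theta ((1 + l * 4) + 2) + 1 + 2 ≡ (1 + l * 4) + 2
theta-slack₂ l = begin
  theta ((1 + l * 4) + 2) + 1 + 2 ≡⟨ cong (λ v → theta v + 1 + 2) (shift l) ⟩
  theta (3 + l * 4) + 1 + 2       ≡⟨ cong (λ t → t + 1 + 2) (theta-3+4l l) ⟩
  4 * l + 1 + 2                   ≡⟨ finish l ⟩
  (1 + l * 4) + 2                 ∎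
  where
  open ≡-Reasoning
  shift : ∀ l → (1 + l * 4) + 2 ≡ 3 + l * 4
  shift = solve-∀
  finish : ∀ l → 4 * l + 1 + 2 ≡ (1 + l * 4) + 2
  finish = solve-∀

theta-slack₃ : ∀ l → theta ((1 + l * 4) + 3) + 1 + 2 ≡ (1 + l * 4) + 3
theta-slack₃ l = begin
  theta ((1 + l * 4) + 3) + 1 + 2 ≡⟨ cong (λ v → theta v + 1 + 2) (shift l) ⟩
  theta (0 + suc l * 4) + 1 + 2   ≡⟨ cong (λ t → t + 1 + 2) (theta-4+4l l) ⟩
  suc (4 * l) + 1 + 2             ≡⟨ finish l ⟩
  (1 + l * 4) + 3                 ∎
  where
  open ≡-Reasoning
  shift : ∀ l → (1 + l * 4) + 3 ≡ 0 + suc l * 4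
  shift = solve-∀
  finish : ∀ l → suc (4 * l) + 1 + 2 ≡ (1 + l * 4) + 3
  finish = solve-∀

theta-slack₄ : ∀ l → theta ((1 + l * 4) + 4) + 1 + 3 ≡ (1 + l * 4) + 4
theta-slack₄ l = begin
  theta ((1 + l * 4) + 4) + 1 + 3 ≡⟨ cong (λ v → theta v + 1 + 3) (shift l) ⟩
  theta (1 + suc l * 4) + 1 + 3   ≡⟨ cong (λ t → t + 1 + 3) (theta-5+4l l) ⟩
  suc (4 * l) + 1 + 3             ≡⟨ finish l ⟩
  (1 + l * 4) + 4                 ∎
  where
  open ≡-Reasoning
  shift : ∀ l → (1 + l * 4) + 4 ≡ 1 + suc l * 4
  shift = solve-∀
  finish : ∀ l → suc (4 * l) + 1 + 3 ≡ (1 + l * 4) + 4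
  finish = solve-∀

hypomorphicPair : ∀ m → ProdPrimePowers1mod4 m → ∀ {r} (E : ExtensionPair r) →
  (∀ l → theta ((1 + l * 4) + r) + 1 + ExtensionPair.slack E ≡ (1 + l * 4) + r) →
  Σ (Graph (m + r)) λ G → Σ (Graph (m + r)) λ G′ →
    (∀ k → theta (m + r) + 1 ≤ k → k ≤ m + r → HypomorphicUpToCompl k G G′) ×
    ¬ SameGraph G′ G × ¬ SameGraph G′ (complement G)
hypomorphicPair m m-ok {r} E theta-slack =
  G S E , G′ S E , (λ k θ<k _ → hypomorphic S E k (within-slack k θ<k)) ,
  distinct-extensions S E vertex , distinct-complement-extensions S E
  where
  open ExtensionPair E using (slack)
  S : FixingAntimorphisms m
  S = productFixing m m-ok
  m≡1+4l : m ≡ 1 + (m / 4) * 4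
  m≡1+4l = trans (m≡m%n+[m/n]*n m 4) (cong (_+ (m / 4) * 4) (product-%4 m m-ok))
  vertex : Fin m
  vertex = subst Fin (sym m≡1+4l) zero
  within-slack : ∀ k → theta (m + r) + 1 ≤ k → m + r ≤ k + slack
  within-slack k θ<k = subst (_≤ k + slack)
    (subst (λ m → theta (m + r) + 1 + slack ≡ m + r) (sym m≡1+4l) (theta-slack (m / 4))) (+-monoˡ-≤ slack θ<k)

proposition4p4 : ∀ (m r : ℕ) → ProdPrimePowers1mod4 m → (r ≡ 2 ⊎ r ≡ 3 ⊎ r ≡ 4) →
    Σ (Graph (m + r)) λ G → Σ (Graph (m + r)) λ G' →
      (∀ k → theta (m + r) + 1 ≤ k → k ≤ m + r → HypomorphicUpToCompl k G G') ×
      ¬ SameGraph G' G × ¬ SameGraph G' (complement G)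
proposition4p4 m .2 m-ok (inj₁ refl)        = hypomorphicPair m m-ok extensionPair₂ theta-slack₂
proposition4p4 m .3 m-ok (inj₂ (inj₁ refl)) = hypomorphicPair m m-ok extensionPair₃ theta-slack₃
proposition4p4 m .4 m-ok (inj₂ (inj₂ refl)) = hypomorphicPair m m-ok extensionPair₄ theta-slack₄
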